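{- Normal-form bisimilarity is sound with respect to contextual equivalence: for all terms $t_0,t_1$ of $\lambda_S$, if $t_0\approx_{nf}t_1$ then $t_0\cong^\circ t_1$ (which for closed terms is $t_0\cong t_1$).
   Context: Calculus $\lambda_S$: terms $t ::= v \mid t\,t \mid \mathcal{S}k.t \mid \langle t\rangle$, values $v ::= x \mid \lambda x.t$; pure contexts $E ::= \square \mid v\,E \mid E\,t$; evaluation contexts $F ::= \square \mid v\,F \mid F\,t \mid \langle F\rangle$ (each is either pure or uniquely $F[\langle E\rangle]$ with $E$ pure); contexts $C ::= \square \mid \lambda x.C \mid t\,C \mid C\,t \mid \mathcal{S}k.C \mid \langle C\rangle$. Reduction (on open terms): $F[(\lambda x.t)\,v] \to F[t\{v/x\}]$; $F[\langle E[\mathcal{S}k.t]\rangle] \to F[\langle t\{\lambda x.\langle E[x]\rangle/k\}\rangle]$ ($x\notin\mathrm{fv}(E)$); $F[\langle v\rangle]\to F[v]$. Stuck terms are exactly control-stuck terms $E[\mathcal{S}k.t]$ and open-stuck terms $F[x\,v]$; normal form: value or stuck term; $t\Downarrow t'$: $t\to^* t'$ with $t'$ normal form. Contextual equivalence on closed terms: $t_0\cong t_1$ iff for every closed $C$, $C[t_0]$ evaluates to a value iff $C[t_1]$ does, and $C[t_0]$ evaluates to a control-stuck term iff $C[t_1]$ does; $t_0\cong^\circ t_1$ iff $t_0\sigma\cong t_1\sigma$ for every substitution $\sigma$ of closed values for the free variables. Extensions of a relation $R$ on open terms ($x$ always a fresh variable): $E_0\,R^c\,E_1$ (pure) iff $E_0[x]\,R\,E_1[x]$;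 $F_0[\langle E_0\rangle]\,R^c\,F_1[\langle E_1\rangle]$ iff $\langle E_0[x]\rangle\,R\,\langle E_1[x]\rangle$ and $F_0[x]\,R\,F_1[x]$ ($R^c$ relates no other pairs); $v_0\,R^v\,v_1$ iff $v_0\,x\,R\,v_1\,x$; $E_0[\mathcal{S}k.t_0]\,R^{nf}\,E_1[\mathcal{S}k.t_1]$ iff $E_0\,R^c\,E_1$ and $\langle t_0\rangle\,R\,\langle t_1\rangle$; $F_0[y\,v_0]\,R^{nf}\,F_1[y\,v_1]$ iff $F_0\,R^c\,F_1$ and $v_0\,R^v\,v_1$. A normal-form bisimulation is a relation $R$ on open terms such that $t_0\,R\,t_1$ implies: if $t_0\to t_0'$ then $t_1\to^*t_1'$ with $t_0'\,R\,t_1'$; if $t_0$ is a value then $t_1\Downarrow v_1$ for a value $v_1$ with $t_0\,R^v\,v_1$; if $t_0$ is stuck then $t_1\Downarrow t_1'$ with $t_0\,R^{nf}\,t_1'$; and the symmetric conditions for $t_1$. $\approx_{nf}$ is the largest normal-form bisimulation. -}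

module Defs where

-- Terms use (unscoped) de Bruijn indices: variables are natural
-- numbers; a binder (λ or 𝒮k) binds index 0 in its body.  A variable index
-- n occurring under d binders is free (as the free variable n ∸ d) iff n ≥ d.

open import Data.Nat using (ℕ; zero; suc; _+_)
open import Data.Empty using (⊥)
open import Data.Sum using (_⊎_)
open import Data.Product using (Σ; _×_; ∃; ∃-syntax)
open import Relation.Nullary using (¬_)
open import Relation.Binary.PropositionalEquality using (_≡_)
open import Relation.Binary.Construct.Closure.ReflexiveTransitive using (Star)
open import Function using (flip)
open import Function.Bundles using (_⇔_)
open import Level using (Level) renaming (suc to lsuc; zero to lzero)

mutual
  data Tm : Set where
    val   : Val → Tm
    app   : Tm → Tm → Tm
    shift : Tm → Tm
    reset : Tm → Tm

  data Val : Set where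
    var : ℕ → Val
    lam : Tm → Val

ext : (ℕ → ℕ) → ℕ → ℕ
ext ρ zero    = zero
ext ρ (suc n) = suc (ρ n)

mutual
  renT : (ℕ → ℕ) → Tm → Tm
  renT ρ (val v)   = val (renV ρ v)
  renT ρ (app s t) = app (renT ρ s) (renT ρ t)
  renT ρ (shift t) = shift (renT (ext ρ) t)
  renT ρ (reset t) = reset (renT ρ t)

  renV : (ℕ → ℕ) → Val → Val
  renV ρ (var n) = var (ρ n)
  renV ρ (lam t) = lam (renT (ext ρ) t)

exts : (ℕ → Val) → ℕ → Val
exts σ zero    = var zero
exts σ (suc n) = renV suc (σ n)

mutual
  subT : (ℕ → Val) → Tm → Tm
  subT σ (val v)   = val (subV σ v)
  subT σ (app s t) = app (subT σ s) (subT σ t)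
  subT σ (shift t) = shift (subT (exts σ) t)
  subT σ (reset t) = reset (subT σ t)

  subV : (ℕ → Val) → Val → Val
  subV σ (var n) = σ n
  subV σ (lam t) = lam (subT (exts σ) t)

single : Val → ℕ → Val
single v zero    = v
single v (suc n) = var n

_[_] : Tm → Val → Tm
t [ v ] = subT (single v) t

-- Free variables:  Free d x t  means that the free variable x occurs in t,
-- where t is considered under d enclosing binders.

mutual
  FreeT : ℕ → ℕ → Tm → Set
  FreeT d x (val v)   = FreeV d x v
  FreeT d x (app s t) = FreeT d x s ⊎ FreeT d x t
  FreeT d x (shift t) = FreeT (suc d) x t
  FreeT d x (reset t) = FreeT d x t

  FreeV : ℕ → ℕ → Val → Set
  FreeV d x (var n) = n ≡ d + x
  FreeV d x (lam t) = FreeT (suc d) x t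

data PCtx : Set where
  □   : PCtx
  _·ᵣ_ : Val → PCtx → PCtx
  _·ₗ_ : PCtx → Tm → PCtx

plugE : PCtx → Tm → Tm
plugE □        u = u
plugE (v ·ᵣ E) u = app (val v) (plugE E u)
plugE (E ·ₗ t) u = app (plugE E u) t

renE : (ℕ → ℕ) → PCtx → PCtx
renE ρ □        = □
renE ρ (v ·ᵣ E) = renV ρ v ·ᵣ renE ρ E
renE ρ (E ·ₗ t) = renE ρ E ·ₗ renT ρ t

FreeE : ℕ → PCtx → Set
FreeE x □        = ⊥
FreeE x (v ·ᵣ E) = FreeV 0 x v ⊎ FreeE x E
FreeE x (E ·ₗ t) = FreeE x E ⊎ FreeT 0 x t

data ECtx : Set where
  □ᶠ    : ECtx
  _·ᵣᶠ_ : Val → ECtx → ECtx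
  _·ₗᶠ_ : ECtx → Tm → ECtx
  ⟨_⟩ᶠ  : ECtx → ECtx

plugF : ECtx → Tm → Tm
plugF □ᶠ        u = u
plugF (v ·ᵣᶠ F) u = app (val v) (plugF F u)
plugF (F ·ₗᶠ t) u = app (plugF F u) t
plugF ⟨ F ⟩ᶠ    u = reset (plugF F u)

FreeF : ℕ → ECtx → Set
FreeF x □ᶠ        = ⊥
FreeF x (v ·ᵣᶠ F) = FreeV 0 x v ⊎ FreeF x F
FreeF x (F ·ₗᶠ t) = FreeF x F ⊎ FreeT 0 x t
FreeF x ⟨ F ⟩ᶠ    = FreeF x F

pure : PCtx → ECtx
pure □        = □ᶠ
pure (v ·ᵣ E) = v ·ᵣᶠ pure E
pure (E ·ₗ t) = pure E ·ₗᶠ t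

-- the evaluation context  F[⟨E⟩]
_⟪_⟫ : ECtx → PCtx → ECtx
□ᶠ        ⟪ E ⟫ = ⟨ pure E ⟩ᶠ
(v ·ᵣᶠ F) ⟪ E ⟫ = v ·ᵣᶠ (F ⟪ E ⟫)
(F ·ₗᶠ t) ⟪ E ⟫ = (F ⟪ E ⟫) ·ₗᶠ t
⟨ F ⟩ᶠ    ⟪ E ⟫ = ⟨ F ⟪ E ⟫ ⟩ᶠ

-- General contexts  C ::= □ | λx.C | t C | C t | 𝒮k.C | ⟨C⟩
-- (plugging may capture variables)

data Ctx : Set where
  □ᶜ     : Ctx
  lamᶜ   : Ctx → Ctx
  _·ᵣᶜ_  : Tm → Ctx → Ctx
  _·ₗᶜ_  : Ctx → Tm → Ctx
  shiftᶜ : Ctx → Ctx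
  resetᶜ : Ctx → Ctx

plugC : Ctx → Tm → Tm
plugC □ᶜ         u = u
plugC (lamᶜ C)   u = val (lam (plugC C u))
plugC (t ·ᵣᶜ C)  u = app t (plugC C u)
plugC (C ·ₗᶜ t)  u = app (plugC C u) t
plugC (shiftᶜ C) u = shift (plugC C u)
plugC (resetᶜ C) u = reset (plugC C u)

FreeC : ℕ → ℕ → Ctx → Set
FreeC d x □ᶜ         = ⊥
FreeC d x (lamᶜ C)   = FreeC (suc d) x C
FreeC d x (t ·ᵣᶜ C)  = FreeT d x t ⊎ FreeC d x C
FreeC d x (C ·ₗᶜ t)  = FreeC d x C ⊎ FreeT d x t
FreeC d x (shiftᶜ C) = FreeC (suc d) x C
FreeC d x (resetᶜ C) = FreeC d x C

ClosedTm : Tm → Set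
ClosedTm t = ∀ x → ¬ FreeT 0 x t

ClosedVal : Val → Set
ClosedVal v = ∀ x → ¬ FreeV 0 x v

ClosedCtx : Ctx → Set
ClosedCtx C = ∀ x → ¬ FreeC 0 x C

-- the captured continuation  λx.⟨E[x]⟩  (x fresh, i.e. index 0 after shifting E)
contV : PCtx → Val
contV E = lam (reset (plugE (renE suc E) (val (var zero))))

data _⟶_ : Tm → Tm → Set where
  βv    : ∀ F t v → plugF F (app (val (lam t)) (val v)) ⟶ plugF F (t [ v ])
  shiftβ : ∀ F E t →
          plugF F (reset (plugE E (shift t))) ⟶ plugF F (reset (t [ contV E ]))
  resetβ : ∀ F v → plugF F (reset (val v)) ⟶ plugF F (val v)

_⟶*_ : Tm → Tm → Set
_⟶*_ = Star _⟶_

ControlStuck : Tm → Set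
ControlStuck t = ∃[ E ] ∃[ b ] t ≡ plugE E (shift b)

OpenStuck : Tm → Set
OpenStuck t = ∃[ F ] ∃[ y ] ∃[ v ] t ≡ plugF F (app (val (var y)) (val v))

IsValue : Tm → Set
IsValue t = ∃[ v ] t ≡ val v

Stuck : Tm → Set
Stuck t = ControlStuck t ⊎ OpenStuck t

NormalForm : Tm → Set
NormalForm t = IsValue t ⊎ Stuck t

_⇓_ : Tm → Tm → Set
t ⇓ t' = (t ⟶* t') × NormalForm t'

EvalsToValue : Tm → Set
EvalsToValue t = ∃[ v ] t ⟶* val v

EvalsToControlStuck : Tm → Set
EvalsToControlStuck t = ∃[ t' ] (t ⟶* t') × ControlStuck t'

_≅_ : Tm → Tm → Set
t₀ ≅ t₁ = ∀ (C : Ctx) → ClosedCtx C →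
  (EvalsToValue (plugC C t₀) ⇔ EvalsToValue (plugC C t₁)) ×
  (EvalsToControlStuck (plugC C t₀) ⇔ EvalsToControlStuck (plugC C t₁))

_≅°_ : Tm → Tm → Set
t₀ ≅° t₁ = ∀ (σ : ℕ → Val) → (∀ n → ClosedVal (σ n)) → subT σ t₀ ≅ subT σ t₁

Rel : Set₁
Rel = Tm → Tm → Set

PureExt : Rel → PCtx → PCtx → Set
PureExt R E₀ E₁ = ∀ x → ¬ FreeE x E₀ → ¬ FreeE x E₁ →
  R (plugE E₀ (val (var x))) (plugE E₁ (val (var x)))

CtxExt : Rel → ECtx → ECtx → Set
CtxExt R F₀ F₁ =
  (∃[ E₀ ] ∃[ E₁ ] F₀ ≡ pure E₀ × F₁ ≡ pure E₁ × PureExt R E₀ E₁)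
  ⊎
  (∃[ G₀ ] ∃[ E₀ ] ∃[ G₁ ] ∃[ E₁ ] F₀ ≡ G₀ ⟪ E₀ ⟫ × F₁ ≡ G₁ ⟪ E₁ ⟫ ×
     (∀ x → ¬ FreeE x E₀ → ¬ FreeE x E₁ →
        R (reset (plugE E₀ (val (var x)))) (reset (plugE E₁ (val (var x))))) ×
     (∀ x → ¬ FreeF x G₀ → ¬ FreeF x G₁ →
        R (plugF G₀ (val (var x))) (plugF G₁ (val (var x)))))

ValExt : Rel → Val → Val → Set
ValExt R v₀ v₁ = ∀ x → ¬ FreeV 0 x v₀ → ¬ FreeV 0 x v₁ →
  R (app (val v₀) (val (var x))) (app (val v₁) (val (var x)))

-- R^nf on stuck terms.  In E[𝒮k.t] the bound k is renamed to any variable k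
-- not free in the bodies (α-conversion), giving the open term ⟨t⟩.
NFExt : Rel → Tm → Tm → Set
NFExt R t₀ t₁ =
  (∃[ E₀ ] ∃[ b₀ ] ∃[ E₁ ] ∃[ b₁ ]
     t₀ ≡ plugE E₀ (shift b₀) × t₁ ≡ plugE E₁ (shift b₁) ×
     PureExt R E₀ E₁ ×
     (∀ k → ¬ FreeT 1 k b₀ → ¬ FreeT 1 k b₁ →
        R (reset (b₀ [ var k ])) (reset (b₁ [ var k ]))))
  ⊎
  (∃[ F₀ ] ∃[ y ] ∃[ v₀ ] ∃[ F₁ ] ∃[ v₁ ]
     t₀ ≡ plugF F₀ (app (val (var y)) (val v₀)) ×
     t₁ ≡ plugF F₁ (app (val (var y)) (val v₁)) ×
     CtxExt R F₀ F₁ × ValExt R v₀ v₁)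

Progress : Rel → Tm → Tm → Set
Progress R t₀ t₁ =
  (∀ t₀' → t₀ ⟶ t₀' → ∃[ t₁' ] (t₁ ⟶* t₁') × R t₀' t₁') ×
  (∀ v₀ → t₀ ≡ val v₀ → ∃[ v₁ ] (t₁ ⇓ val v₁) × ValExt R v₀ v₁) ×
  (Stuck t₀ → ∃[ t₁' ] (t₁ ⇓ t₁') × NFExt R t₀ t₁')

IsNFBisimulation : Rel → Set
IsNFBisimulation R = ∀ t₀ t₁ → R t₀ t₁ →
  Progress R t₀ t₁ × Progress (flip R) t₁ t₀

_≈nf_ : Tm → Tm → Set₁
t₀ ≈nf t₁ = ∃[ R ] IsNFBisimulation R × R t₀ t₁

-- Let R be a normal-form bisimulation.  Close R to a relation ∼ on open terms: ∼
-- contains every instance σ₀ t₀ ∼ σ₁ t₁ of t₀ R t₁ by pointwise related values, the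
-- instances of the context extensions of R (pure contexts E, delimited contexts ⟨E⟩
-- and the contexts F around a reset) with related terms plugged in, and it is
-- compatible with every term constructor.  Then ∼ is a simulation for the observable
-- behaviour: a step on the left is matched by finitely many steps on the right, a
-- value by a related value, and a control-stuck term E₀[𝒮k.b₀] by a control-stuck
-- term with related context and body.  For the instances this is exactly what the
-- bisimulation clauses of R provide; the substitution can only turn an open-stuck
-- term F[y v] into a redex, and then the value substituted for y is itself related.
-- Since ∼ contains R and is compatible, it relates C[σ t₀] and C[σ t₁] for every
-- context C, and the symmetric clauses of R give the converse implications.

module Submission where

open import Defs
open import Data.Nat using (ℕ; zero; suc; _+_; _<_; _⊔_; s≤s)
open import Data.Nat.Properties using (_≟_; m≤m⊔n; m≤n⊔m; ≤-trans; <-irrefl; m≤n+m; ≤-refl; n≤1+n)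
open import Data.Empty using (⊥-elim)
open import Data.Sum using (_⊎_; inj₁; inj₂)
open import Data.Product using (∃; ∃₂; _×_; _,_; proj₁; proj₂)
open import Relation.Nullary using (¬_; yes; no)
open import Relation.Binary.PropositionalEquality hiding ([_])
open import Relation.Binary.Construct.Closure.ReflexiveTransitive using (Star; ε; _◅_; _◅◅_; gmap)
open import Function using (_∘_; id; flip)
open import Function.Bundles using (_⇔_; mk⇔)

-- Renaming and substitution

ext-cong : ∀ {ρ ρ'} → ρ ≗ ρ' → ext ρ ≗ ext ρ'
ext-cong h zero    = refl
ext-cong h (suc n) = cong suc (h n)

ext-∘ : ∀ ρ' ρ → ext ρ' ∘ ext ρ ≗ ext (ρ' ∘ ρ)
ext-∘ ρ' ρ zero    = refl
ext-∘ ρ' ρ (suc n) = refl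

exts-cong : ∀ {σ τ} → σ ≗ τ → exts σ ≗ exts τ
exts-cong h zero    = refl
exts-cong h (suc n) = cong (renV suc) (h n)

exts-ext : ∀ σ ρ → exts σ ∘ ext ρ ≗ exts (σ ∘ ρ)
exts-ext σ ρ zero    = refl
exts-ext σ ρ (suc n) = refl

exts-var : exts var ≗ var
exts-var zero    = refl
exts-var (suc n) = refl

var-ext : ∀ ρ → var ∘ ext ρ ≗ exts (var ∘ ρ)
var-ext ρ zero    = refl
var-ext ρ (suc n) = refl

mutual
  renT-cong : ∀ {ρ ρ'} → ρ ≗ ρ' → renT ρ ≗ renT ρ'
  renT-cong h (val v)   = cong val (renV-cong h v)
  renT-cong h (app s t) = cong₂ app (renT-cong h s) (renT-cong h t)
  renT-cong h (shift t) = cong shift (renT-cong (ext-cong h) t)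
  renT-cong h (reset t) = cong reset (renT-cong h t)

  renV-cong : ∀ {ρ ρ'} → ρ ≗ ρ' → renV ρ ≗ renV ρ'
  renV-cong h (var n) = cong var (h n)
  renV-cong h (lam t) = cong lam (renT-cong (ext-cong h) t)

mutual
  subT-cong : ∀ {σ τ} → σ ≗ τ → subT σ ≗ subT τ
  subT-cong h (val v)   = cong val (subV-cong h v)
  subT-cong h (app s t) = cong₂ app (subT-cong h s) (subT-cong h t)
  subT-cong h (shift t) = cong shift (subT-cong (exts-cong h) t)
  subT-cong h (reset t) = cong reset (subT-cong h t)

  subV-cong : ∀ {σ τ} → σ ≗ τ → subV σ ≗ subV τ
  subV-cong h (var n) = h n
  subV-cong h (lam t) = cong lam (subT-cong (exts-cong h) t)

mutual
  renT-renT : ∀ ρ' ρ t → renT ρ' (renT ρ t) ≡ renT (ρ' ∘ ρ) t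
  renT-renT ρ' ρ (val v)   = cong val (renV-renV ρ' ρ v)
  renT-renT ρ' ρ (app s t) = cong₂ app (renT-renT ρ' ρ s) (renT-renT ρ' ρ t)
  renT-renT ρ' ρ (shift t) = cong shift (trans (renT-renT (ext ρ') (ext ρ) t) (renT-cong (ext-∘ ρ' ρ) t))
  renT-renT ρ' ρ (reset t) = cong reset (renT-renT ρ' ρ t)

  renV-renV : ∀ ρ' ρ v → renV ρ' (renV ρ v) ≡ renV (ρ' ∘ ρ) v
  renV-renV ρ' ρ (var n) = refl
  renV-renV ρ' ρ (lam t) = cong lam (trans (renT-renT (ext ρ') (ext ρ) t) (renT-cong (ext-∘ ρ' ρ) t))

mutual
  renT-subT : ∀ ρ σ t → renT ρ (subT σ t) ≡ subT (renV ρ ∘ σ) t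
  renT-subT ρ σ (val v)   = cong val (renV-subV ρ σ v)
  renT-subT ρ σ (app s t) = cong₂ app (renT-subT ρ σ s) (renT-subT ρ σ t)
  renT-subT ρ σ (shift t) = cong shift (trans (renT-subT (ext ρ) (exts σ) t) (subT-cong (ren-exts ρ σ) t))
  renT-subT ρ σ (reset t) = cong reset (renT-subT ρ σ t)

  renV-subV : ∀ ρ σ v → renV ρ (subV σ v) ≡ subV (renV ρ ∘ σ) v
  renV-subV ρ σ (var n) = refl
  renV-subV ρ σ (lam t) = cong lam (trans (renT-subT (ext ρ) (exts σ) t) (subT-cong (ren-exts ρ σ) t))

  ren-exts : ∀ ρ σ → renV (ext ρ) ∘ exts σ ≗ exts (renV ρ ∘ σ)
  ren-exts ρ σ zero    = refl
  ren-exts ρ σ (suc n) = trans (renV-renV (ext ρ) suc (σ n)) (sym (renV-renV suc ρ (σ n)))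

mutual
  subT-renT : ∀ σ ρ t → subT σ (renT ρ t) ≡ subT (σ ∘ ρ) t
  subT-renT σ ρ (val v)   = cong val (subV-renV σ ρ v)
  subT-renT σ ρ (app s t) = cong₂ app (subT-renT σ ρ s) (subT-renT σ ρ t)
  subT-renT σ ρ (shift t) = cong shift (trans (subT-renT (exts σ) (ext ρ) t) (subT-cong (exts-ext σ ρ) t))
  subT-renT σ ρ (reset t) = cong reset (subT-renT σ ρ t)

  subV-renV : ∀ σ ρ v → subV σ (renV ρ v) ≡ subV (σ ∘ ρ) v
  subV-renV σ ρ (var n) = refl
  subV-renV σ ρ (lam t) = cong lam (trans (subT-renT (exts σ) (ext ρ) t) (subT-cong (exts-ext σ ρ) t))

mutual
  subT-subT : ∀ τ σ t → subT τ (subT σ t) ≡ subT (subV τ ∘ σ) t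
  subT-subT τ σ (val v)   = cong val (subV-subV τ σ v)
  subT-subT τ σ (app s t) = cong₂ app (subT-subT τ σ s) (subT-subT τ σ t)
  subT-subT τ σ (shift t) = cong shift (trans (subT-subT (exts τ) (exts σ) t) (subT-cong (sub-exts τ σ) t))
  subT-subT τ σ (reset t) = cong reset (subT-subT τ σ t)

  subV-subV : ∀ τ σ v → subV τ (subV σ v) ≡ subV (subV τ ∘ σ) v
  subV-subV τ σ (var n) = refl
  subV-subV τ σ (lam t) = cong lam (trans (subT-subT (exts τ) (exts σ) t) (subT-cong (sub-exts τ σ) t))

  sub-exts : ∀ τ σ → subV (exts τ) ∘ exts σ ≗ exts (subV τ ∘ σ)
  sub-exts τ σ zero    = refl
  sub-exts τ σ (suc n) = trans (subV-renV (exts τ) suc (σ n)) (sym (renV-subV suc τ (σ n)))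

mutual
  subT-var : ∀ t → subT var t ≡ t
  subT-var (val v)   = cong val (subV-var v)
  subT-var (app s t) = cong₂ app (subT-var s) (subT-var t)
  subT-var (shift t) = cong shift (trans (subT-cong exts-var t) (subT-var t))
  subT-var (reset t) = cong reset (subT-var t)

  subV-var : ∀ v → subV var v ≡ v
  subV-var (var n) = refl
  subV-var (lam t) = cong lam (trans (subT-cong exts-var t) (subT-var t))

mutual
  renT-as-subT : ∀ ρ t → renT ρ t ≡ subT (var ∘ ρ) t
  renT-as-subT ρ (val v)   = cong val (renV-as-subV ρ v)
  renT-as-subT ρ (app s t) = cong₂ app (renT-as-subT ρ s) (renT-as-subT ρ t)
  renT-as-subT ρ (shift t) = cong shift (trans (renT-as-subT (ext ρ) t) (subT-cong (var-ext ρ) t))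
  renT-as-subT ρ (reset t) = cong reset (renT-as-subT ρ t)

  renV-as-subV : ∀ ρ v → renV ρ v ≡ subV (var ∘ ρ) v
  renV-as-subV ρ (var n) = refl
  renV-as-subV ρ (lam t) = cong lam (trans (renT-as-subT (ext ρ) t) (subT-cong (var-ext ρ) t))

renV-id : ∀ v → renV id v ≡ v
renV-id v = trans (renV-as-subV id v) (subV-var v)

subT-single : ∀ σ t v → subT σ (t [ v ]) ≡ subT (exts σ) t [ subV σ v ]
subT-single σ t v = trans (subT-subT σ (single v) t)
  (trans (subT-cong agree t) (sym (subT-subT (single (subV σ v)) (exts σ) t)))
  where
  agree : subV σ ∘ single v ≗ subV (single (subV σ v)) ∘ exts σ
  agree zero    = refl
  agree (suc n) = sym (trans (subV-renV (single (subV σ v)) suc (σ n)) (subV-var (σ n)))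

-- Evaluation contexts

subE : (ℕ → Val) → PCtx → PCtx
subE σ □        = □
subE σ (v ·ᵣ E) = subV σ v ·ᵣ subE σ E
subE σ (E ·ₗ t) = subE σ E ·ₗ subT σ t

subF : (ℕ → Val) → ECtx → ECtx
subF σ □ᶠ        = □ᶠ
subF σ (v ·ᵣᶠ F) = subV σ v ·ᵣᶠ subF σ F
subF σ (F ·ₗᶠ t) = subF σ F ·ₗᶠ subT σ t
subF σ ⟨ F ⟩ᶠ    = ⟨ subF σ F ⟩ᶠ

infixr 20 _∘E_ _∘F_

_∘E_ : PCtx → PCtx → PCtx
□        ∘E B = B
(v ·ᵣ A) ∘E B = v ·ᵣ (A ∘E B)
(A ·ₗ t) ∘E B = (A ∘E B) ·ₗ t

_∘F_ : ECtx → ECtx → ECtx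
□ᶠ        ∘F B = B
(v ·ᵣᶠ A) ∘F B = v ·ᵣᶠ (A ∘F B)
(A ·ₗᶠ t) ∘F B = (A ∘F B) ·ₗᶠ t
⟨ A ⟩ᶠ    ∘F B = ⟨ A ∘F B ⟩ᶠ

plugE-∘ : ∀ A B u → plugE (A ∘E B) u ≡ plugE A (plugE B u)
plugE-∘ □        B u = refl
plugE-∘ (v ·ᵣ A) B u = cong (app (val v)) (plugE-∘ A B u)
plugE-∘ (A ·ₗ t) B u = cong (λ z → app z t) (plugE-∘ A B u)

plugF-∘ : ∀ A B u → plugF (A ∘F B) u ≡ plugF A (plugF B u)
plugF-∘ □ᶠ        B u = refl
plugF-∘ (v ·ᵣᶠ A) B u = cong (app (val v)) (plugF-∘ A B u)
plugF-∘ (A ·ₗᶠ t) B u = cong (λ z → app z t) (plugF-∘ A B u)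
plugF-∘ ⟨ A ⟩ᶠ    B u = cong reset (plugF-∘ A B u)

plugF-pure : ∀ E u → plugF (pure E) u ≡ plugE E u
plugF-pure □        u = refl
plugF-pure (v ·ᵣ E) u = cong (app (val v)) (plugF-pure E u)
plugF-pure (E ·ₗ t) u = cong (λ z → app z t) (plugF-pure E u)

plugF-⟪⟫ : ∀ G E u → plugF (G ⟪ E ⟫) u ≡ plugF G (reset (plugE E u))
plugF-⟪⟫ □ᶠ        E u = cong reset (plugF-pure E u)
plugF-⟪⟫ (v ·ᵣᶠ G) E u = cong (app (val v)) (plugF-⟪⟫ G E u)
plugF-⟪⟫ (G ·ₗᶠ t) E u = cong (λ z → app z t) (plugF-⟪⟫ G E u)
plugF-⟪⟫ ⟨ G ⟩ᶠ    E u = cong reset (plugF-⟪⟫ G E u)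

plugF-pure-∘ : ∀ E F u → plugF (pure E ∘F F) u ≡ plugE E (plugF F u)
plugF-pure-∘ E F u = trans (plugF-∘ (pure E) F u) (plugF-pure E _)

subT-plugE : ∀ σ E u → subT σ (plugE E u) ≡ plugE (subE σ E) (subT σ u)
subT-plugE σ □        u = refl
subT-plugE σ (v ·ᵣ E) u = cong (app (val (subV σ v))) (subT-plugE σ E u)
subT-plugE σ (E ·ₗ t) u = cong (λ z → app z (subT σ t)) (subT-plugE σ E u)

subT-plugF : ∀ σ F u → subT σ (plugF F u) ≡ plugF (subF σ F) (subT σ u)
subT-plugF σ □ᶠ        u = refl
subT-plugF σ (v ·ᵣᶠ F) u = cong (app (val (subV σ v))) (subT-plugF σ F u)
subT-plugF σ (F ·ₗᶠ t) u = cong (λ z → app z (subT σ t)) (subT-plugF σ F u)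
subT-plugF σ ⟨ F ⟩ᶠ    u = cong reset (subT-plugF σ F u)

subF-pure : ∀ σ E → subF σ (pure E) ≡ pure (subE σ E)
subF-pure σ □        = refl
subF-pure σ (v ·ᵣ E) = cong (subV σ v ·ᵣᶠ_) (subF-pure σ E)
subF-pure σ (E ·ₗ t) = cong (_·ₗᶠ subT σ t) (subF-pure σ E)

subF-⟪⟫ : ∀ σ G E → subF σ (G ⟪ E ⟫) ≡ subF σ G ⟪ subE σ E ⟫
subF-⟪⟫ σ □ᶠ        E = cong ⟨_⟩ᶠ (subF-pure σ E)
subF-⟪⟫ σ (v ·ᵣᶠ G) E = cong (subV σ v ·ᵣᶠ_) (subF-⟪⟫ σ G E)
subF-⟪⟫ σ (G ·ₗᶠ t) E = cong (_·ₗᶠ subT σ t) (subF-⟪⟫ σ G E)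
subF-⟪⟫ σ ⟨ G ⟩ᶠ    E = cong ⟨_⟩ᶠ (subF-⟪⟫ σ G E)

subE-∘ : ∀ σ A B → subE σ (A ∘E B) ≡ subE σ A ∘E subE σ B
subE-∘ σ □        B = refl
subE-∘ σ (v ·ᵣ A) B = cong (subV σ v ·ᵣ_) (subE-∘ σ A B)
subE-∘ σ (A ·ₗ t) B = cong (_·ₗ subT σ t) (subE-∘ σ A B)

subE-cong : ∀ {σ τ} → σ ≗ τ → subE σ ≗ subE τ
subE-cong h □        = refl
subE-cong h (v ·ᵣ E) = cong₂ _·ᵣ_ (subV-cong h v) (subE-cong h E)
subE-cong h (E ·ₗ t) = cong₂ _·ₗ_ (subE-cong h E) (subT-cong h t)

subE-subE : ∀ τ σ E → subE τ (subE σ E) ≡ subE (subV τ ∘ σ) E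
subE-subE τ σ □        = refl
subE-subE τ σ (v ·ᵣ E) = cong₂ _·ᵣ_ (subV-subV τ σ v) (subE-subE τ σ E)
subE-subE τ σ (E ·ₗ t) = cong₂ _·ₗ_ (subE-subE τ σ E) (subT-subT τ σ t)

subF-subF : ∀ τ σ F → subF τ (subF σ F) ≡ subF (subV τ ∘ σ) F
subF-subF τ σ □ᶠ        = refl
subF-subF τ σ (v ·ᵣᶠ F) = cong₂ _·ᵣᶠ_ (subV-subV τ σ v) (subF-subF τ σ F)
subF-subF τ σ (F ·ₗᶠ t) = cong₂ _·ₗᶠ_ (subF-subF τ σ F) (subT-subT τ σ t)
subF-subF τ σ ⟨ F ⟩ᶠ    = cong ⟨_⟩ᶠ (subF-subF τ σ F)

renE-as-subE : ∀ ρ E → renE ρ E ≡ subE (var ∘ ρ) E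
renE-as-subE ρ □        = refl
renE-as-subE ρ (v ·ᵣ E) = cong₂ _·ᵣ_ (renV-as-subV ρ v) (renE-as-subE ρ E)
renE-as-subE ρ (E ·ₗ t) = cong₂ _·ₗ_ (renE-as-subE ρ E) (renT-as-subT ρ t)

subT-plugE-subE : ∀ τ σ E u → subT τ (plugE (subE σ E) u) ≡ plugE (subE (subV τ ∘ σ) E) (subT τ u)
subT-plugE-subE τ σ E u = trans (subT-plugE τ (subE σ E) u) (cong (λ z → plugE z (subT τ u)) (subE-subE τ σ E))

subT-plugF-subF : ∀ τ σ F u → subT τ (plugF (subF σ F) u) ≡ plugF (subF (subV τ ∘ σ) F) (subT τ u)
subT-plugF-subF τ σ F u = trans (subT-plugF τ (subF σ F) u) (cong (λ z → plugF z (subT τ u)) (subF-subF τ σ F))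

contV-as-lam : ∀ E → contV E ≡ lam (reset (plugE (subE (var ∘ suc) E) (val (var zero))))
contV-as-lam E = cong (λ A → lam (reset (plugE A (val (var zero))))) (renE-as-subE suc E)

subV-contV : ∀ σ E → subV σ (contV E) ≡ contV (subE σ E)
subV-contV σ E = begin
  subV σ (contV E)
    ≡⟨ cong (subV σ) (contV-as-lam E) ⟩
  lam (reset (subT (exts σ) (plugE (subE (var ∘ suc) E) (val (var zero)))))
    ≡⟨ cong (lam ∘ reset) (subT-plugE (exts σ) (subE (var ∘ suc) E) (val (var zero))) ⟩
  lam (reset (plugE (subE (exts σ) (subE (var ∘ suc) E)) (val (var zero))))
    ≡⟨ cong (λ A → lam (reset (plugE A (val (var zero))))) lift-commutes ⟩
  lam (reset (plugE (subE (var ∘ suc) (subE σ E)) (val (var zero))))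
    ≡⟨ sym (contV-as-lam (subE σ E)) ⟩
  contV (subE σ E) ∎
  where
  open ≡-Reasoning
  lift-commutes : subE (exts σ) (subE (var ∘ suc) E) ≡ subE (var ∘ suc) (subE σ E)
  lift-commutes = trans (subE-subE (exts σ) (var ∘ suc) E)
    (trans (subE-cong (λ n → renV-as-subV suc (σ n)) E) (sym (subE-subE (var ∘ suc) σ E)))

plugE-subE-∘E : ∀ τ σ A B p → plugE (subE τ (subE σ A ∘E B)) p ≡ plugE (subE (subV τ ∘ σ) A) (plugE (subE τ B) p)
plugE-subE-∘E τ σ A B p = begin
  plugE (subE τ (subE σ A ∘E B)) p             ≡⟨ cong (λ C → plugE C p) (subE-∘ τ (subE σ A) B) ⟩
  plugE (subE τ (subE σ A) ∘E subE τ B) p      ≡⟨ plugE-∘ (subE τ (subE σ A)) (subE τ B) p ⟩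
  plugE (subE τ (subE σ A)) (plugE (subE τ B) p) ≡⟨ cong (λ C → plugE C (plugE (subE τ B) p)) (subE-subE τ σ A) ⟩
  plugE (subE (subV τ ∘ σ) A) (plugE (subE τ B) p) ∎
  where open ≡-Reasoning

□ᶠ≡pure⇒□ : ∀ E → □ᶠ ≡ pure E → E ≡ □
□ᶠ≡pure⇒□ □        refl = refl
□ᶠ≡pure⇒□ (v ·ᵣ E) ()
□ᶠ≡pure⇒□ (E ·ₗ t) ()

□ᶠ≢⟪⟫ : ∀ G E → □ᶠ ≢ G ⟪ E ⟫
□ᶠ≢⟪⟫ □ᶠ        E ()
□ᶠ≢⟪⟫ (v ·ᵣᶠ G) E ()
□ᶠ≢⟪⟫ (G ·ₗᶠ t) E ()
□ᶠ≢⟪⟫ ⟨ G ⟩ᶠ    E ()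

-- Reduction as a congruence-closed relation

data Step : Tm → Tm → Set where
  βᵥ     : ∀ t v → Step (app (val (lam t)) (val v)) (t [ v ])
  βshift : ∀ E t → Step (reset (plugE E (shift t))) (reset (t [ contV E ]))
  βreset : ∀ v → Step (reset (val v)) (val v)
  appˡ   : ∀ {a a'} b → Step a a' → Step (app a b) (app a' b)
  appʳ   : ∀ v {b b'} → Step b b' → Step (app (val v) b) (app (val v) b')
  reset  : ∀ {a a'} → Step a a' → Step (reset a) (reset a')

Steps : Tm → Tm → Set
Steps = Star Step

plugE-Step : ∀ E {q q'} → Step q q' → Step (plugE E q) (plugE E q')
plugE-Step □        st = st
plugE-Step (v ·ᵣ E) st = appʳ v (plugE-Step E st)
plugE-Step (E ·ₗ t) st = appˡ t (plugE-Step E st)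

plugF-Step : ∀ F {q q'} → Step q q' → Step (plugF F q) (plugF F q')
plugF-Step □ᶠ        st = st
plugF-Step (v ·ᵣᶠ F) st = appʳ v (plugF-Step F st)
plugF-Step (F ·ₗᶠ t) st = appˡ t (plugF-Step F st)
plugF-Step ⟨ F ⟩ᶠ    st = reset (plugF-Step F st)

plugE-Steps : ∀ E {q q'} → Steps q q' → Steps (plugE E q) (plugE E q')
plugE-Steps E = gmap (plugE E) (plugE-Step E)

plugF-Steps : ∀ F {q q'} → Steps q q' → Steps (plugF F q) (plugF F q')
plugF-Steps F = gmap (plugF F) (plugF-Step F)

appˡ-Steps : ∀ b {q q'} → Steps q q' → Steps (app q b) (app q' b)
appˡ-Steps b = gmap (λ z → app z b) (appˡ b)

appʳ-Steps : ∀ v {q q'} → Steps q q' → Steps (app (val v) q) (app (val v) q')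
appʳ-Steps v = gmap (app (val v)) (appʳ v)

reset-Steps : ∀ {q q'} → Steps q q' → Steps (reset q) (reset q')
reset-Steps = gmap reset reset

≡-Steps : ∀ {a b c d} → a ≡ b → Steps b c → c ≡ d → Steps a d
≡-Steps refl st refl = st

⟶-plugF : ∀ G {t t'} → t ⟶ t' → plugF G t ⟶ plugF G t'
⟶-plugF G (βv F t v)     = subst₂ _⟶_ (plugF-∘ G F _) (plugF-∘ G F _) (βv (G ∘F F) t v)
⟶-plugF G (shiftβ F E t) = subst₂ _⟶_ (plugF-∘ G F _) (plugF-∘ G F _) (shiftβ (G ∘F F) E t)
⟶-plugF G (resetβ F v)   = subst₂ _⟶_ (plugF-∘ G F _) (plugF-∘ G F _) (resetβ (G ∘F F) v)

⟶⇒Step : ∀ {t t'} → t ⟶ t' → Step t t'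
⟶⇒Step (βv F t v)     = plugF-Step F (βᵥ t v)
⟶⇒Step (shiftβ F E t) = plugF-Step F (βshift E t)
⟶⇒Step (resetβ F v)   = plugF-Step F (βreset v)

Step⇒⟶ : ∀ {t t'} → Step t t' → t ⟶ t'
Step⇒⟶ (βᵥ t v)     = βv □ᶠ t v
Step⇒⟶ (βshift E t) = shiftβ □ᶠ E t
Step⇒⟶ (βreset v)   = resetβ □ᶠ v
Step⇒⟶ (appˡ b st)  = ⟶-plugF (□ᶠ ·ₗᶠ b) (Step⇒⟶ st)
Step⇒⟶ (appʳ v st)  = ⟶-plugF (v ·ᵣᶠ □ᶠ) (Step⇒⟶ st)
Step⇒⟶ (reset st)   = ⟶-plugF ⟨ □ᶠ ⟩ᶠ (Step⇒⟶ st)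

⟶*⇒Steps : ∀ {t t'} → t ⟶* t' → Steps t t'
⟶*⇒Steps = gmap id ⟶⇒Step

Steps⇒⟶* : ∀ {t t'} → Steps t t' → t ⟶* t'
Steps⇒⟶* = gmap id Step⇒⟶

subT-Step : ∀ σ {t t'} → Step t t' → Step (subT σ t) (subT σ t')
subT-Step σ (βᵥ t v) = subst (Step _) (sym (subT-single σ t v)) (βᵥ (subT (exts σ) t) (subV σ v))
subT-Step σ (βshift E t) =
  subst₂ Step (cong reset (sym (subT-plugE σ E (shift t))))
    (cong reset (trans (cong (subT (exts σ) t [_]) (sym (subV-contV σ E))) (sym (subT-single σ t (contV E)))))
    (βshift (subE σ E) (subT (exts σ) t))
subT-Step σ (βreset v)  = βreset (subV σ v)
subT-Step σ (appˡ b st) = appˡ (subT σ b) (subT-Step σ st)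
subT-Step σ (appʳ v st) = appʳ (subV σ v) (subT-Step σ st)
subT-Step σ (reset st)  = reset (subT-Step σ st)

subT-Steps : ∀ σ {t t'} → Steps t t' → Steps (subT σ t) (subT σ t')
subT-Steps σ = gmap (subT σ) (subT-Step σ)

app-injˡ : ∀ {a b c d} → app a b ≡ app c d → a ≡ c
app-injˡ refl = refl

app-injʳ : ∀ {a b c d} → app a b ≡ app c d → b ≡ d
app-injʳ refl = refl

val-injective : ∀ {v w} → val v ≡ val w → v ≡ w
val-injective refl = refl

val≢plugE-shift : ∀ {v} E {t} → val v ≢ plugE E (shift t)
val≢plugE-shift □        ()
val≢plugE-shift (_ ·ᵣ E) ()
val≢plugE-shift (E ·ₗ _) ()

reset≢plugE-shift : ∀ {a} E {t} → reset a ≢ plugE E (shift t)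
reset≢plugE-shift □        ()
reset≢plugE-shift (_ ·ᵣ E) ()
reset≢plugE-shift (E ·ₗ _) ()

NotValue : Tm → Set
NotValue u = ∀ w → u ≢ val w

NotControl : Tm → Set
NotControl u = ∀ E t → u ≢ plugE E (shift t)

plugF≢val : ∀ {u} → NotValue u → ∀ F {w} → plugF F u ≢ val w
plugF≢val nv □ᶠ        eq = nv _ eq
plugF≢val nv (_ ·ᵣᶠ F) ()
plugF≢val nv (F ·ₗᶠ _) ()
plugF≢val nv ⟨ F ⟩ᶠ    ()

plugF≢plugE-shift : ∀ {u} → NotValue u → NotControl u → ∀ F E {t} → plugF F u ≢ plugE E (shift t)
plugF≢plugE-shift nv nc □ᶠ        E        eq = nc E _ eq
plugF≢plugE-shift nv nc (_ ·ᵣᶠ F) □        ()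
plugF≢plugE-shift nv nc (_ ·ᵣᶠ F) (_ ·ᵣ E) eq = plugF≢plugE-shift nv nc F E (app-injʳ eq)
plugF≢plugE-shift nv nc (_ ·ᵣᶠ F) (E ·ₗ _) eq = val≢plugE-shift E (app-injˡ eq)
plugF≢plugE-shift nv nc (F ·ₗᶠ _) □        ()
plugF≢plugE-shift nv nc (F ·ₗᶠ _) (_ ·ᵣ E) eq = plugF≢val nv F (app-injˡ eq)
plugF≢plugE-shift nv nc (F ·ₗᶠ _) (E ·ₗ _) eq = plugF≢plugE-shift nv nc F E (app-injˡ eq)
plugF≢plugE-shift nv nc ⟨ F ⟩ᶠ    E        eq = reset≢plugE-shift E eq

appVal-NotValue : ∀ {a b} → NotValue (app (val a) (val b))
appVal-NotValue w ()

appVal-NotControl : ∀ {a b} → NotControl (app (val a) (val b))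
appVal-NotControl □        t ()
appVal-NotControl (_ ·ᵣ E) t eq = val≢plugE-shift E (app-injʳ eq)
appVal-NotControl (E ·ₗ _) t eq = val≢plugE-shift E (app-injˡ eq)

reset-NotValue : ∀ {a} → NotValue (reset a)
reset-NotValue w ()

reset-NotControl : ∀ {a} → NotControl (reset a)
reset-NotControl E t = reset≢plugE-shift E

plugF-appVal≢plugE-shift : ∀ F E {a b t} → plugF F (app (val a) (val b)) ≢ plugE E (shift t)
plugF-appVal≢plugE-shift F E = plugF≢plugE-shift appVal-NotValue appVal-NotControl F E

plugE-shift-injective : ∀ E E' {t t'} → plugE E (shift t) ≡ plugE E' (shift t') → E ≡ E' × t ≡ t'
plugE-shift-injective □        □         refl = refl , refl
plugE-shift-injective □        (_ ·ᵣ _)  ()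
plugE-shift-injective □        (_ ·ₗ _)  ()
plugE-shift-injective (_ ·ᵣ E) □         ()
plugE-shift-injective (_ ·ᵣ E) (_ ·ᵣ E') eq
  with val-injective (app-injˡ eq) | plugE-shift-injective E E' (app-injʳ eq)
... | refl | refl , refl = refl , refl
plugE-shift-injective (_ ·ᵣ E) (E' ·ₗ _) eq = ⊥-elim (val≢plugE-shift E' (app-injˡ eq))
plugE-shift-injective (E ·ₗ _) □         ()
plugE-shift-injective (E ·ₗ _) (_ ·ᵣ E') eq = ⊥-elim (val≢plugE-shift E (sym (app-injˡ eq)))
plugE-shift-injective (E ·ₗ _) (E' ·ₗ _) eq
  with plugE-shift-injective E E' (app-injˡ eq) | app-injʳ eq
... | refl , refl | refl = refl , refl

appVal≡plugF-inv : ∀ F {a b a' b'} → app (val a) (val b) ≡ plugF F (app (val a') (val b')) →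
  F ≡ □ᶠ × a ≡ a' × b ≡ b'
appVal≡plugF-inv □ᶠ        refl = refl , refl , refl
appVal≡plugF-inv (_ ·ᵣᶠ F) eq   = ⊥-elim (plugF≢val appVal-NotValue F (sym (app-injʳ eq)))
appVal≡plugF-inv (F ·ₗᶠ _) eq   = ⊥-elim (plugF≢val appVal-NotValue F (sym (app-injˡ eq)))
appVal≡plugF-inv ⟨ F ⟩ᶠ    ()

val-irreducible : ∀ {w s} → ¬ Step (val w) s
val-irreducible ()

Step-app-inv : ∀ {a b s} → Step (app a b) s →
  (∃₂ λ t v → a ≡ val (lam t) × b ≡ val v × s ≡ t [ v ]) ⊎
  (∃ λ a' → Step a a' × s ≡ app a' b) ⊎
  (∃₂ λ v b' → a ≡ val v × Step b b' × s ≡ app (val v) b')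
Step-app-inv (βᵥ t v)    = inj₁ (t , v , refl , refl , refl)
Step-app-inv (appˡ b st) = inj₂ (inj₁ (_ , st , refl))
Step-app-inv (appʳ v st) = inj₂ (inj₂ (v , _ , refl , st , refl))

Step-reset-inv : ∀ {a s} → Step (reset a) s →
  (∃₂ λ E t → a ≡ plugE E (shift t) × s ≡ reset (t [ contV E ])) ⊎
  (∃ λ v → a ≡ val v × s ≡ val v) ⊎
  (∃ λ a' → Step a a' × s ≡ reset a')
Step-reset-inv (βshift E t) = inj₁ (E , t , refl , refl)
Step-reset-inv (βreset v)   = inj₂ (inj₁ (v , refl , refl))
Step-reset-inv (reset st)   = inj₂ (inj₂ (_ , st , refl))

control-irreducible : ∀ E {t s} → ¬ Step (plugE E (shift t)) s
control-irreducible □ ()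
control-irreducible (v ·ᵣ E) st with Step-app-inv st
... | inj₁ (_ , _ , _ , eq , _)          = val≢plugE-shift E (sym eq)
... | inj₂ (inj₁ (_ , st' , _))          = val-irreducible st'
... | inj₂ (inj₂ (_ , _ , _ , st' , _))  = control-irreducible E st'
control-irreducible (E ·ₗ x) st with Step-app-inv st
... | inj₁ (_ , _ , eq , _ , _)          = val≢plugE-shift E (sym eq)
... | inj₂ (inj₁ (_ , st' , _))          = control-irreducible E st'
... | inj₂ (inj₂ (_ , _ , eq , _ , _))   = val≢plugE-shift E (sym eq)

open-stuck-irreducible : ∀ F {y v s} → ¬ Step (plugF F (app (val (var y)) (val v))) s
open-stuck-irreducible □ᶠ (appˡ _ ())
open-stuck-irreducible □ᶠ (appʳ _ ())
open-stuck-irreducible (x ·ᵣᶠ F) st with Step-app-inv st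
... | inj₁ (_ , _ , _ , eq , _)          = plugF≢val appVal-NotValue F eq
... | inj₂ (inj₁ (_ , st' , _))          = val-irreducible st'
... | inj₂ (inj₂ (_ , _ , _ , st' , _))  = open-stuck-irreducible F st'
open-stuck-irreducible (F ·ₗᶠ x) st with Step-app-inv st
... | inj₁ (_ , _ , eq , _ , _)          = plugF≢val appVal-NotValue F eq
... | inj₂ (inj₁ (_ , st' , _))          = open-stuck-irreducible F st'
... | inj₂ (inj₂ (_ , _ , eq , _ , _))   = plugF≢val appVal-NotValue F eq
open-stuck-irreducible ⟨ F ⟩ᶠ st with Step-reset-inv st
... | inj₁ (E , _ , eq , _)              = plugF-appVal≢plugE-shift F E eq
... | inj₂ (inj₁ (_ , eq , _))           = plugF≢val appVal-NotValue F eq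
... | inj₂ (inj₂ (_ , st' , _))          = open-stuck-irreducible F st'

Step-deterministic : ∀ {t a b} → Step t a → Step t b → a ≡ b
Step-deterministic (βᵥ t v) (βᵥ .t .v) = refl
Step-deterministic (βᵥ t v) (appˡ _ ())
Step-deterministic (βᵥ t v) (appʳ _ ())
Step-deterministic (βshift E t) st with Step-reset-inv st
... | inj₁ (E' , t' , eq , refl) with plugE-shift-injective E E' eq
...   | refl , refl = refl
Step-deterministic (βshift E t) st | inj₂ (inj₁ (_ , eq , _))  = ⊥-elim (val≢plugE-shift E (sym eq))
Step-deterministic (βshift E t) st | inj₂ (inj₂ (_ , st' , _)) = ⊥-elim (control-irreducible E st')
Step-deterministic (βreset v) st with Step-reset-inv st
... | inj₁ (E' , t' , eq , refl)  = ⊥-elim (val≢plugE-shift E' eq)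
... | inj₂ (inj₁ (_ , refl , refl)) = refl
... | inj₂ (inj₂ (_ , st' , _))     = ⊥-elim (val-irreducible st')
Step-deterministic (appˡ b st) (βᵥ t v)      = ⊥-elim (val-irreducible st)
Step-deterministic (appˡ b st) (appˡ .b st') = cong (λ z → app z b) (Step-deterministic st st')
Step-deterministic (appˡ b st) (appʳ v st')  = ⊥-elim (val-irreducible st)
Step-deterministic (appʳ v st) (βᵥ t w)      = ⊥-elim (val-irreducible st)
Step-deterministic (appʳ v st) (appˡ _ st')  = ⊥-elim (val-irreducible st')
Step-deterministic (appʳ v st) (appʳ .v st') = cong (app (val v)) (Step-deterministic st st')
Step-deterministic (reset st) (βshift E t)   = ⊥-elim (control-irreducible E st)
Step-deterministic (reset st) (βreset v)     = ⊥-elim (val-irreducible st)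
Step-deterministic (reset st) (reset st')    = cong reset (Step-deterministic st st')

data Shape (t : Tm) : Set where
  value      : ∀ v → t ≡ val v → Shape t
  reducible  : ∀ t' → Step t t' → Shape t
  control    : ∀ E b → t ≡ plugE E (shift b) → Shape t
  open-stuck : ∀ F y v → t ≡ plugF F (app (val (var y)) (val v)) → Shape t

shape : ∀ t → Shape t
shape (val v)   = value v refl
shape (shift b) = control □ b refl
shape (app s t) with shape s
... | reducible s' st     = reducible _ (appˡ t st)
... | control E b refl    = control (E ·ₗ t) b refl
... | open-stuck F y v refl = open-stuck (F ·ₗᶠ t) y v refl
... | value v refl with shape t
...   | reducible t' st     = reducible _ (appʳ v st)
...   | control E b refl    = control (v ·ᵣ E) b refl
...   | open-stuck F y w refl = open-stuck (v ·ᵣᶠ F) y w refl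
...   | value w refl with v
...     | var y = open-stuck □ᶠ y w refl
...     | lam b = reducible _ (βᵥ b w)
shape (reset s) with shape s
... | value v refl        = reducible _ (βreset v)
... | reducible s' st     = reducible _ (reset st)
... | control E b refl    = reducible _ (βshift E b)
... | open-stuck F y v refl = open-stuck ⟨ F ⟩ᶠ y v refl

plugF-redex-Step : ∀ F {a b s} → Step (plugF F (app (val a) (val b))) s →
  ∃ λ c → Step (app (val a) (val b)) c × s ≡ plugF F c
plugF-redex-Step F {var y} st = ⊥-elim (open-stuck-irreducible F st)
plugF-redex-Step F {lam t} {b} st = _ , βᵥ t b , Step-deterministic st (plugF-Step F (βᵥ t b))

Step-reset-result : ∀ {r q} → Step (reset r) q → (∃ λ r' → q ≡ reset r') ⊎ (∃ λ v → q ≡ val v)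
Step-reset-result (βshift E t) = inj₁ (_ , refl)
Step-reset-result (βreset v)   = inj₂ (v , refl)
Step-reset-result (reset st)   = inj₁ (_ , refl)

-- Free variables, fresh variables and substitution update

mutual
  OccursT : ℕ → Tm → Set
  OccursT n (val v)   = OccursV n v
  OccursT n (app s t) = OccursT n s ⊎ OccursT n t
  OccursT n (shift t) = OccursT (suc n) t
  OccursT n (reset t) = OccursT n t

  OccursV : ℕ → Val → Set
  OccursV n (var m) = m ≡ n
  OccursV n (lam t) = OccursT (suc n) t

mutual
  OccursT⇒FreeT : ∀ d x t → OccursT (d + x) t → FreeT d x t
  OccursT⇒FreeT d x (val v)   o        = OccursV⇒FreeV d x v o
  OccursT⇒FreeT d x (app s t) (inj₁ o) = inj₁ (OccursT⇒FreeT d x s o)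
  OccursT⇒FreeT d x (app s t) (inj₂ o) = inj₂ (OccursT⇒FreeT d x t o)
  OccursT⇒FreeT d x (shift t) o        = OccursT⇒FreeT (suc d) x t o
  OccursT⇒FreeT d x (reset t) o        = OccursT⇒FreeT d x t o

  OccursV⇒FreeV : ∀ d x v → OccursV (d + x) v → FreeV d x v
  OccursV⇒FreeV d x (var n) o = o
  OccursV⇒FreeV d x (lam t) o = OccursT⇒FreeT (suc d) x t o

mutual
  FreeT⇒OccursT : ∀ d x t → FreeT d x t → OccursT (d + x) t
  FreeT⇒OccursT d x (val v)   f        = FreeV⇒OccursV d x v f
  FreeT⇒OccursT d x (app s t) (inj₁ f) = inj₁ (FreeT⇒OccursT d x s f)
  FreeT⇒OccursT d x (app s t) (inj₂ f) = inj₂ (FreeT⇒OccursT d x t f)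
  FreeT⇒OccursT d x (shift t) f        = FreeT⇒OccursT (suc d) x t f
  FreeT⇒OccursT d x (reset t) f        = FreeT⇒OccursT d x t f

  FreeV⇒OccursV : ∀ d x v → FreeV d x v → OccursV (d + x) v
  FreeV⇒OccursV d x (var n) f = f
  FreeV⇒OccursV d x (lam t) f = FreeT⇒OccursT (suc d) x t f

mutual
  subT-occurs-cong : ∀ {σ τ} t → (∀ n → OccursT n t → σ n ≡ τ n) → subT σ t ≡ subT τ t
  subT-occurs-cong (val v)   h = cong val (subV-occurs-cong v h)
  subT-occurs-cong (app s t) h =
    cong₂ app (subT-occurs-cong s (λ n → h n ∘ inj₁)) (subT-occurs-cong t (λ n → h n ∘ inj₂))
  subT-occurs-cong (shift t) h = cong shift (subT-occurs-cong t (exts-occurs-cong h))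
  subT-occurs-cong (reset t) h = cong reset (subT-occurs-cong t h)

  subV-occurs-cong : ∀ {σ τ} v → (∀ n → OccursV n v → σ n ≡ τ n) → subV σ v ≡ subV τ v
  subV-occurs-cong (var m) h = h m refl
  subV-occurs-cong (lam t) h = cong lam (subT-occurs-cong t (exts-occurs-cong h))

  exts-occurs-cong : ∀ {σ τ} {P : ℕ → Set} → (∀ n → P (suc n) → σ n ≡ τ n) → ∀ n → P n → exts σ n ≡ exts τ n
  exts-occurs-cong h zero    o = refl
  exts-occurs-cong h (suc n) o = cong (renV suc) (h n o)

mutual
  varBoundT : Tm → ℕ
  varBoundT (val v)   = varBoundV v
  varBoundT (app s t) = varBoundT s ⊔ varBoundT t
  varBoundT (shift t) = varBoundT t
  varBoundT (reset t) = varBoundT t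

  varBoundV : Val → ℕ
  varBoundV (var m) = suc m
  varBoundV (lam t) = varBoundT t

mutual
  OccursT⇒<varBoundT : ∀ n t → OccursT n t → n < varBoundT t
  OccursT⇒<varBoundT n (val v)   o        = OccursV⇒<varBoundV n v o
  OccursT⇒<varBoundT n (app s t) (inj₁ o) = ≤-trans (OccursT⇒<varBoundT n s o) (m≤m⊔n _ _)
  OccursT⇒<varBoundT n (app s t) (inj₂ o) = ≤-trans (OccursT⇒<varBoundT n t o) (m≤n⊔m _ _)
  OccursT⇒<varBoundT n (shift t) o        = ≤-trans (n≤1+n (suc n)) (OccursT⇒<varBoundT (suc n) t o)
  OccursT⇒<varBoundT n (reset t) o        = OccursT⇒<varBoundT n t o

  OccursV⇒<varBoundV : ∀ n v → OccursV n v → n < varBoundV v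
  OccursV⇒<varBoundV n (var m) refl = ≤-refl
  OccursV⇒<varBoundV n (lam t) o    = ≤-trans (n≤1+n (suc n)) (OccursT⇒<varBoundT (suc n) t o)

-- Binders only lower the indices of free variables, so varBoundT t is fresh at every depth.
fresh : ∀ t → ∃ λ x → ∀ d → ¬ FreeT d x t
fresh t = varBoundT t , λ d f →
  <-irrefl refl (≤-trans (s≤s (m≤n+m (varBoundT t) d)) (OccursT⇒<varBoundT _ t (FreeT⇒OccursT d _ t f)))

FreeE⇒FreeT : ∀ x E u → FreeE x E → FreeT 0 x (plugE E u)
FreeE⇒FreeT x (v ·ᵣ E) u (inj₁ f) = inj₁ f
FreeE⇒FreeT x (v ·ᵣ E) u (inj₂ f) = inj₂ (FreeE⇒FreeT x E u f)
FreeE⇒FreeT x (E ·ₗ t) u (inj₁ f) = inj₁ (FreeE⇒FreeT x E u f)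
FreeE⇒FreeT x (E ·ₗ t) u (inj₂ f) = inj₂ f

FreeF⇒FreeT : ∀ x F u → FreeF x F → FreeT 0 x (plugF F u)
FreeF⇒FreeT x (v ·ᵣᶠ F) u (inj₁ f) = inj₁ f
FreeF⇒FreeT x (v ·ᵣᶠ F) u (inj₂ f) = inj₂ (FreeF⇒FreeT x F u f)
FreeF⇒FreeT x (F ·ₗᶠ t) u (inj₁ f) = inj₁ (FreeF⇒FreeT x F u f)
FreeF⇒FreeT x (F ·ₗᶠ t) u (inj₂ f) = inj₂ f
FreeF⇒FreeT x ⟨ F ⟩ᶠ    u f        = FreeF⇒FreeT x F u f

fresh-PCtx² : ∀ E₀ E₁ → ∃ λ x → ¬ FreeE x E₀ × ¬ FreeE x E₁
fresh-PCtx² E₀ E₁ with fresh (app (plugE E₀ (val (var 0))) (plugE E₁ (val (var 0))))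
... | x , nf = x , (λ f → nf 0 (inj₁ (FreeE⇒FreeT x E₀ _ f))) , (λ f → nf 0 (inj₂ (FreeE⇒FreeT x E₁ _ f)))

fresh-ECtx² : ∀ F₀ F₁ → ∃ λ x → ¬ FreeF x F₀ × ¬ FreeF x F₁
fresh-ECtx² F₀ F₁ with fresh (app (plugF F₀ (val (var 0))) (plugF F₁ (val (var 0))))
... | x , nf = x , (λ f → nf 0 (inj₁ (FreeF⇒FreeT x F₀ _ f))) , (λ f → nf 0 (inj₂ (FreeF⇒FreeT x F₁ _ f)))

fresh-Val² : ∀ v₀ v₁ → ∃ λ x → ¬ FreeV 0 x v₀ × ¬ FreeV 0 x v₁
fresh-Val² v₀ v₁ with fresh (app (val v₀) (val v₁))
... | x , nf = x , (λ f → nf 0 (inj₁ f)) , (λ f → nf 0 (inj₂ f))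

fresh-body² : ∀ b₀ b₁ → ∃ λ x → ¬ FreeT 1 x b₀ × ¬ FreeT 1 x b₁
fresh-body² b₀ b₁ with fresh (app b₀ b₁)
... | x , nf = x , (λ f → nf 1 (inj₁ f)) , (λ f → nf 1 (inj₂ f))

update : (ℕ → Val) → ℕ → Val → ℕ → Val
update σ x w n with n ≟ x
... | yes _ = w
... | no _  = σ n

update-hit : ∀ σ x w → update σ x w x ≡ w
update-hit σ x w with x ≟ x
... | yes _ = refl
... | no x≢x = ⊥-elim (x≢x refl)

update-miss : ∀ σ x w {n} → n ≢ x → update σ x w n ≡ σ n
update-miss σ x w {n} n≢x with n ≟ x
... | yes n≡x = ⊥-elim (n≢x n≡x)
... | no _    = refl

update-fresh : ∀ σ x w {n} {P : Set} → (n ≡ x → P) → ¬ P → update σ x w n ≡ σ n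
update-fresh σ x w occ nf = update-miss σ x w (nf ∘ occ)

subT-update-fresh : ∀ σ x w t → ¬ FreeT 0 x t → subT (update σ x w) t ≡ subT σ t
subT-update-fresh σ x w t nf = subT-occurs-cong t λ n o →
  update-fresh σ x w (λ { refl → OccursT⇒FreeT 0 n t o }) nf

subV-update-fresh : ∀ σ x w v → ¬ FreeV 0 x v → subV (update σ x w) v ≡ subV σ v
subV-update-fresh σ x w v nf = val-injective (subT-update-fresh σ x w (val v) nf)

subE-update-fresh : ∀ σ x w E → ¬ FreeE x E → subE (update σ x w) E ≡ subE σ E
subE-update-fresh σ x w □        nf = refl
subE-update-fresh σ x w (v ·ᵣ E) nf =
  cong₂ _·ᵣ_ (subV-update-fresh σ x w v (nf ∘ inj₁)) (subE-update-fresh σ x w E (nf ∘ inj₂))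
subE-update-fresh σ x w (E ·ₗ t) nf =
  cong₂ _·ₗ_ (subE-update-fresh σ x w E (nf ∘ inj₁)) (subT-update-fresh σ x w t (nf ∘ inj₂))

subF-update-fresh : ∀ σ x w F → ¬ FreeF x F → subF (update σ x w) F ≡ subF σ F
subF-update-fresh σ x w □ᶠ        nf = refl
subF-update-fresh σ x w (v ·ᵣᶠ F) nf =
  cong₂ _·ᵣᶠ_ (subV-update-fresh σ x w v (nf ∘ inj₁)) (subF-update-fresh σ x w F (nf ∘ inj₂))
subF-update-fresh σ x w (F ·ₗᶠ t) nf =
  cong₂ _·ₗᶠ_ (subF-update-fresh σ x w F (nf ∘ inj₁)) (subT-update-fresh σ x w t (nf ∘ inj₂))
subF-update-fresh σ x w ⟨ F ⟩ᶠ    nf = cong ⟨_⟩ᶠ (subF-update-fresh σ x w F nf)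

plugE-as-update : ∀ σ x w E → ¬ FreeE x E →
  plugE (subE σ E) (val w) ≡ subT (update σ x w) (plugE E (val (var x)))
plugE-as-update σ x w E nf = sym (trans (subT-plugE (update σ x w) E (val (var x)))
  (cong₂ plugE (subE-update-fresh σ x w E nf) (cong val (update-hit σ x w))))

plugF-as-update : ∀ σ x w F → ¬ FreeF x F →
  plugF (subF σ F) (val w) ≡ subT (update σ x w) (plugF F (val (var x)))
plugF-as-update σ x w F nf = sym (trans (subT-plugF (update σ x w) F (val (var x)))
  (cong₂ plugF (subF-update-fresh σ x w F nf) (cong val (update-hit σ x w))))

app-as-update : ∀ σ x w v → ¬ FreeV 0 x v →
  app (val (subV σ v)) (val w) ≡ subT (update σ x w) (app (val v) (val (var x)))
app-as-update σ x w v nf =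
  cong₂ app (cong val (sym (subV-update-fresh σ x w v nf))) (cong val (sym (update-hit σ x w)))

body-as-update : ∀ σ k c b → ¬ FreeT 1 k b → subT (exts σ) b [ c ] ≡ subT (update σ k c) (b [ var k ])
body-as-update σ k c b nf = trans (subT-subT (single c) (exts σ) b)
  (trans (subT-occurs-cong b agree) (sym (subT-subT (update σ k c) (single (var k)) b)))
  where
  agree : ∀ n → OccursT n b → subV (single c) (exts σ n) ≡ subV (update σ k c) (single (var k) n)
  agree zero    o = sym (update-hit σ k c)
  agree (suc m) o = trans (trans (subV-renV (single c) suc (σ m)) (subV-var (σ m)))
    (sym (update-fresh σ k c (λ { refl → OccursT⇒FreeT 1 m b o }) nf))

-- Closure of a relation under instantiation, context extension and compatibility

module Closure (R : Rel) where

  ResetExt : PCtx → PCtx → Set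
  ResetExt E₀ E₁ = ∀ x → ¬ FreeE x E₀ → ¬ FreeE x E₁ →
    R (reset (plugE E₀ (val (var x)))) (reset (plugE E₁ (val (var x))))

  OuterExt : ECtx → ECtx → Set
  OuterExt G₀ G₁ = ∀ x → ¬ FreeF x G₀ → ¬ FreeF x G₁ →
    R (plugF G₀ (val (var x))) (plugF G₁ (val (var x)))

  infix 4 _∼_ _∼ᵛ_ _∼ˢ_ _∼ʳˢ_ _∼ᴱ_ _∼ᴮ_

  mutual
    data _∼_ : Tm → Tm → Set where
      inst       : ∀ {t₀ t₁ σ₀ σ₁} → R t₀ t₁ → (∀ n → σ₀ n ∼ᵛ σ₁ n) → subT σ₀ t₀ ∼ subT σ₁ t₁
      inst-pure  : ∀ {E₀ E₁ σ₀ σ₁ q₀ q₁} → PureExt R E₀ E₁ → (∀ n → σ₀ n ∼ᵛ σ₁ n) → q₀ ∼ q₁ →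
                   plugE (subE σ₀ E₀) q₀ ∼ plugE (subE σ₁ E₁) q₁
      inst-reset : ∀ {E₀ E₁ σ₀ σ₁ q₀ q₁} → ResetExt E₀ E₁ → (∀ n → σ₀ n ∼ᵛ σ₁ n) → q₀ ∼ q₁ →
                   reset (plugE (subE σ₀ E₀) q₀) ∼ reset (plugE (subE σ₁ E₁) q₁)
      -- As in F[⟨E⟩], the outer context is filled with a reset, which is neither a value nor control-stuck.
      inst-outer : ∀ {G₀ G₁ σ₀ σ₁ r₀ q₁} → OuterExt G₀ G₁ → (∀ n → σ₀ n ∼ᵛ σ₁ n) → reset r₀ ∼ q₁ →
                   plugF (subF σ₀ G₀) (reset r₀) ∼ plugF (subF σ₁ G₁) q₁
      ∼val       : ∀ {v w} → v ∼ᵛ w → val v ∼ val w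
      ∼app       : ∀ {a₀ a₁ b₀ b₁} → a₀ ∼ a₁ → b₀ ∼ b₁ → app a₀ b₀ ∼ app a₁ b₁
      ∼shift     : ∀ {a₀ a₁} → a₀ ∼ a₁ → shift a₀ ∼ shift a₁
      ∼reset     : ∀ {a₀ a₁} → a₀ ∼ a₁ → reset a₀ ∼ reset a₁

    data _∼ᵛ_ : Val → Val → Set where
      instᵛ : ∀ {v₀ v₁ σ₀ σ₁} → ValExt R v₀ v₁ → (∀ n → σ₀ n ∼ᵛ σ₁ n) → subV σ₀ v₀ ∼ᵛ subV σ₁ v₁
      ∼var  : ∀ n → var n ∼ᵛ var n
      ∼lam  : ∀ {a b} → a ∼ b → lam a ∼ᵛ lam b

  _∼ˢ_ : (ℕ → Val) → (ℕ → Val) → Set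
  σ₀ ∼ˢ σ₁ = ∀ n → σ₀ n ∼ᵛ σ₁ n

  -- Substitutions have to stay related under renaming to be pushed under binders.
  _∼ʳˢ_ : (ℕ → Val) → (ℕ → Val) → Set
  τ₀ ∼ʳˢ τ₁ = ∀ ρ → renV ρ ∘ τ₀ ∼ˢ renV ρ ∘ τ₁

  exts-∼ʳˢ : ∀ {τ₀ τ₁} → τ₀ ∼ʳˢ τ₁ → exts τ₀ ∼ʳˢ exts τ₁
  exts-∼ʳˢ θ ρ zero = ∼var (ρ zero)
  exts-∼ʳˢ {τ₀} {τ₁} θ ρ (suc n) =
    subst₂ _∼ᵛ_ (sym (renV-renV ρ suc (τ₀ n))) (sym (renV-renV ρ suc (τ₁ n))) (θ (ρ ∘ suc) n)

  ∼ʳˢ⇒∼ˢ : ∀ {τ₀ τ₁} → τ₀ ∼ʳˢ τ₁ → τ₀ ∼ˢ τ₁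
  ∼ʳˢ⇒∼ˢ {τ₀} {τ₁} θ n = subst₂ _∼ᵛ_ (renV-id (τ₀ n)) (renV-id (τ₁ n)) (θ id n)

  mutual
    subT-∼ : ∀ {a₀ a₁ τ₀ τ₁} → a₀ ∼ a₁ → τ₀ ∼ʳˢ τ₁ → subT τ₀ a₀ ∼ subT τ₁ a₁
    subT-∼ {τ₀ = τ₀} {τ₁} (inst {t₀} {t₁} {σ₀} {σ₁} r σ∼) θ =
      subst₂ _∼_ (sym (subT-subT τ₀ σ₀ t₀)) (sym (subT-subT τ₁ σ₁ t₁)) (inst r (λ n → subV-∼ᵛ (σ∼ n) θ))
    subT-∼ {τ₀ = τ₀} {τ₁} (inst-pure {E₀} {E₁} {σ₀} {σ₁} {q₀} {q₁} e σ∼ q∼) θ =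
      subst₂ _∼_ (sym (subT-plugE-subE τ₀ σ₀ E₀ q₀)) (sym (subT-plugE-subE τ₁ σ₁ E₁ q₁))
        (inst-pure e (λ n → subV-∼ᵛ (σ∼ n) θ) (subT-∼ q∼ θ))
    subT-∼ {τ₀ = τ₀} {τ₁} (inst-reset {E₀} {E₁} {σ₀} {σ₁} {q₀} {q₁} e σ∼ q∼) θ =
      subst₂ _∼_ (cong reset (sym (subT-plugE-subE τ₀ σ₀ E₀ q₀))) (cong reset (sym (subT-plugE-subE τ₁ σ₁ E₁ q₁)))
        (inst-reset e (λ n → subV-∼ᵛ (σ∼ n) θ) (subT-∼ q∼ θ))
    subT-∼ {τ₀ = τ₀} {τ₁} (inst-outer {G₀} {G₁} {σ₀} {σ₁} {r₀} {q₁} e σ∼ q∼) θ =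
      subst₂ _∼_ (sym (subT-plugF-subF τ₀ σ₀ G₀ (reset r₀))) (sym (subT-plugF-subF τ₁ σ₁ G₁ q₁))
        (inst-outer e (λ n → subV-∼ᵛ (σ∼ n) θ) (subT-∼ q∼ θ))
    subT-∼ (∼val v∼)   θ = ∼val (subV-∼ᵛ v∼ θ)
    subT-∼ (∼app a∼ b∼) θ = ∼app (subT-∼ a∼ θ) (subT-∼ b∼ θ)
    subT-∼ (∼shift a∼) θ = ∼shift (subT-∼ a∼ (exts-∼ʳˢ θ))
    subT-∼ (∼reset a∼) θ = ∼reset (subT-∼ a∼ θ)

    subV-∼ᵛ : ∀ {a₀ a₁ τ₀ τ₁} → a₀ ∼ᵛ a₁ → τ₀ ∼ʳˢ τ₁ → subV τ₀ a₀ ∼ᵛ subV τ₁ a₁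
    subV-∼ᵛ {τ₀ = τ₀} {τ₁} (instᵛ {v₀} {v₁} {σ₀} {σ₁} e σ∼) θ =
      subst₂ _∼ᵛ_ (sym (subV-subV τ₀ σ₀ v₀)) (sym (subV-subV τ₁ σ₁ v₁)) (instᵛ e (λ n → subV-∼ᵛ (σ∼ n) θ))
    subV-∼ᵛ (∼var n) θ = ∼ʳˢ⇒∼ˢ θ n
    subV-∼ᵛ (∼lam a∼) θ = ∼lam (subT-∼ a∼ (exts-∼ʳˢ θ))

  var-∼ʳˢ : ∀ ρ → var ∘ ρ ∼ʳˢ var ∘ ρ
  var-∼ʳˢ ρ ρ' n = ∼var (ρ' (ρ n))

  single-∼ʳˢ : ∀ {b₀ b₁} → b₀ ∼ᵛ b₁ → single b₀ ∼ʳˢ single b₁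
  single-∼ʳˢ {b₀} {b₁} b∼ ρ zero =
    subst₂ _∼ᵛ_ (sym (renV-as-subV ρ b₀)) (sym (renV-as-subV ρ b₁)) (subV-∼ᵛ b∼ (var-∼ʳˢ ρ))
  single-∼ʳˢ b∼ ρ (suc n) = ∼var (ρ n)

  []-∼ : ∀ {t₀ t₁ b₀ b₁} → t₀ ∼ t₁ → b₀ ∼ᵛ b₁ → t₀ [ b₀ ] ∼ t₁ [ b₁ ]
  []-∼ t∼ b∼ = subT-∼ t∼ (single-∼ʳˢ b∼)

  mutual
    ∼-refl : ∀ t → t ∼ t
    ∼-refl (val v)   = ∼val (∼ᵛ-refl v)
    ∼-refl (app s t) = ∼app (∼-refl s) (∼-refl t)
    ∼-refl (shift t) = ∼shift (∼-refl t)
    ∼-refl (reset t) = ∼reset (∼-refl t)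

    ∼ᵛ-refl : ∀ v → v ∼ᵛ v
    ∼ᵛ-refl (var n) = ∼var n
    ∼ᵛ-refl (lam t) = ∼lam (∼-refl t)

  plugC-∼ : ∀ C {u₀ u₁} → u₀ ∼ u₁ → plugC C u₀ ∼ plugC C u₁
  plugC-∼ □ᶜ         u∼ = u∼
  plugC-∼ (lamᶜ C)   u∼ = ∼val (∼lam (plugC-∼ C u∼))
  plugC-∼ (t ·ᵣᶜ C)  u∼ = ∼app (∼-refl t) (plugC-∼ C u∼)
  plugC-∼ (C ·ₗᶜ t)  u∼ = ∼app (plugC-∼ C u∼) (∼-refl t)
  plugC-∼ (shiftᶜ C) u∼ = ∼shift (plugC-∼ C u∼)
  plugC-∼ (resetᶜ C) u∼ = ∼reset (plugC-∼ C u∼)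

  update-∼ˢ : ∀ {σ₀ σ₁ w₀ w₁} → σ₀ ∼ˢ σ₁ → ∀ x → w₀ ∼ᵛ w₁ → update σ₀ x w₀ ∼ˢ update σ₁ x w₁
  update-∼ˢ σ∼ x w∼ n with n ≟ x
  ... | yes _ = w∼
  ... | no _  = σ∼ n

  CtxExt-∼ : ∀ {F₀ F₁ σ₀ σ₁ c₀ c₁} → CtxExt R F₀ F₁ → σ₀ ∼ˢ σ₁ → c₀ ∼ c₁ →
    plugF (subF σ₀ F₀) c₀ ∼ plugF (subF σ₁ F₁) c₁
  CtxExt-∼ {σ₀ = σ₀} {σ₁} {c₀} {c₁} (inj₁ (E₀ , E₁ , refl , refl , e)) σ∼ c∼ =
    subst₂ _∼_ (pure-eq σ₀ E₀ c₀) (pure-eq σ₁ E₁ c₁) (inst-pure e σ∼ c∼)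
    where
    pure-eq : ∀ σ E u → plugE (subE σ E) u ≡ plugF (subF σ (pure E)) u
    pure-eq σ E u = sym (trans (cong (λ F → plugF F u) (subF-pure σ E)) (plugF-pure (subE σ E) u))
  CtxExt-∼ {σ₀ = σ₀} {σ₁} {c₀} {c₁} (inj₂ (G₀ , E₀ , G₁ , E₁ , refl , refl , re , ge)) σ∼ c∼ =
    subst₂ _∼_ (delimited-eq σ₀ G₀ E₀ c₀) (delimited-eq σ₁ G₁ E₁ c₁) (inst-outer ge σ∼ (inst-reset re σ∼ c∼))
    where
    delimited-eq : ∀ σ G E u → plugF (subF σ G) (reset (plugE (subE σ E) u)) ≡ plugF (subF σ (G ⟪ E ⟫)) u
    delimited-eq σ G E u =
      sym (trans (cong (λ F → plugF F u) (subF-⟪⟫ σ G E)) (plugF-⟪⟫ (subF σ G) (subE σ E) u))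

  -- Related pure contexts are only ever needed weakened, inside a captured continuation.
  _∼ᴱ_ : PCtx → PCtx → Set
  E₀ ∼ᴱ E₁ = ∀ {q₀ q₁} → q₀ ∼ q₁ → plugE (subE (var ∘ suc) E₀) q₀ ∼ plugE (subE (var ∘ suc) E₁) q₁

  _∼ᴮ_ : Tm → Tm → Set
  b₀ ∼ᴮ b₁ = ∀ {c₀ c₁} → c₀ ∼ᵛ c₁ → reset (b₀ [ c₀ ]) ∼ reset (b₁ [ c₁ ])

  contV-∼ᵛ : ∀ {E₀ E₁} → E₀ ∼ᴱ E₁ → contV E₀ ∼ᵛ contV E₁
  contV-∼ᵛ {E₀} {E₁} E∼ =
    subst₂ _∼ᵛ_ (sym (contV-as-lam E₀)) (sym (contV-as-lam E₁)) (∼lam (∼reset (E∼ (∼val (∼var zero)))))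

  weaken-∼ˢ : ∀ {σ₀ σ₁} → σ₀ ∼ˢ σ₁ → subV (var ∘ suc) ∘ σ₀ ∼ˢ subV (var ∘ suc) ∘ σ₁
  weaken-∼ˢ σ∼ n = subV-∼ᵛ (σ∼ n) (var-∼ʳˢ suc)

  inst-pure-∘E-∼ᴱ : ∀ {E₀ E₁ σ₀ σ₁ A₀ A₁} → PureExt R E₀ E₁ → σ₀ ∼ˢ σ₁ → A₀ ∼ᴱ A₁ →
    subE σ₀ E₀ ∘E A₀ ∼ᴱ subE σ₁ E₁ ∘E A₁
  inst-pure-∘E-∼ᴱ {E₀} {E₁} {σ₀} {σ₁} {A₀} {A₁} e σ∼ A∼ {p₀} {p₁} p∼ =
    subst₂ _∼_ (sym (plugE-subE-∘E (var ∘ suc) σ₀ E₀ A₀ p₀)) (sym (plugE-subE-∘E (var ∘ suc) σ₁ E₁ A₁ p₁))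
      (inst-pure e (weaken-∼ˢ σ∼) (A∼ p∼))

  inst-reset-contV-∼ᵛ : ∀ {E₀ E₁ σ₀ σ₁ A₀ A₁} → ResetExt E₀ E₁ → σ₀ ∼ˢ σ₁ → A₀ ∼ᴱ A₁ →
    contV (subE σ₀ E₀ ∘E A₀) ∼ᵛ contV (subE σ₁ E₁ ∘E A₁)
  inst-reset-contV-∼ᵛ {E₀} {E₁} {σ₀} {σ₁} {A₀} {A₁} e σ∼ A∼ =
    subst₂ _∼ᵛ_ (sym (contV-∘E σ₀ E₀ A₀)) (sym (contV-∘E σ₁ E₁ A₁))
      (∼lam (inst-reset e (weaken-∼ˢ σ∼) (A∼ (∼val (∼var zero)))))
    where
    contV-∘E : ∀ σ E A → contV (subE σ E ∘E A) ≡
      lam (reset (plugE (subE (subV (var ∘ suc) ∘ σ) E) (plugE (subE (var ∘ suc) A) (val (var zero)))))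
    contV-∘E σ E A =
      trans (contV-as-lam (subE σ E ∘E A)) (cong (lam ∘ reset) (plugE-subE-∘E (var ∘ suc) σ E A (val (var zero))))

  open-stuck-app-NFExt : ∀ {y x t₁} → NFExt R (app (val (var y)) (val (var x))) t₁ →
    ∃₂ λ E₁ u₁ → t₁ ≡ plugE E₁ (app (val (var y)) (val u₁)) × PureExt R □ E₁ × ValExt R (var x) u₁
  open-stuck-app-NFExt (inj₁ (E₀ , b , _ , _ , eq , _)) = ⊥-elim (appVal-NotControl E₀ b eq)
  open-stuck-app-NFExt (inj₂ (F₀ , _ , _ , F₁ , u₁ , eq₀ , eq₁ , F∼ , u∼)) with appVal≡plugF-inv F₀ eq₀
  ... | refl , refl , refl with F∼
  ...   | inj₂ (G₀ , E₀ , _ , _ , eq , _) = ⊥-elim (□ᶠ≢⟪⟫ G₀ E₀ eq)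
  ...   | inj₁ (E₀ , E₁ , eq , refl , E∼) with □ᶠ≡pure⇒□ E₀ eq
  ...     | refl = E₁ , u₁ , trans eq₁ (plugF-pure E₁ _) , E∼ , u∼

  inst-pure-∼ᴱ : ∀ {E₀ E₁ σ₀ σ₁} → PureExt R E₀ E₁ → σ₀ ∼ˢ σ₁ → subE σ₀ E₀ ∼ᴱ subE σ₁ E₁
  inst-pure-∼ᴱ {E₀} {E₁} {σ₀} {σ₁} e σ∼ {q₀} {q₁} q∼ =
    subst₂ _∼_ (cong (λ C → plugE C q₀) (sym (subE-subE (var ∘ suc) σ₀ E₀)))
               (cong (λ C → plugE C q₁) (sym (subE-subE (var ∘ suc) σ₁ E₁)))
      (inst-pure e (weaken-∼ˢ σ∼) q∼)

  inst-body-∼ᴮ : ∀ {a₀ a₁ σ₀ σ₁} →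
    (∀ k → ¬ FreeT 1 k a₀ → ¬ FreeT 1 k a₁ → R (reset (a₀ [ var k ])) (reset (a₁ [ var k ]))) →
    σ₀ ∼ˢ σ₁ → subT (exts σ₀) a₀ ∼ᴮ subT (exts σ₁) a₁
  inst-body-∼ᴮ {a₀} {a₁} {σ₀} {σ₁} a∼ σ∼ {c₀} {c₁} c∼ with fresh-body² a₀ a₁
  ... | k , nf₀ , nf₁ =
    subst₂ _∼_ (cong reset (sym (body-as-update σ₀ k c₀ a₀ nf₀))) (cong reset (sym (body-as-update σ₁ k c₁ a₁ nf₁)))
      (inst (a∼ k nf₀ nf₁) (update-∼ˢ σ∼ k c∼))

-- Simulation

module Simulation (R : Rel) (progress : ∀ a b → R a b → Progress R a b) where
  open Closure R

  R-step : ∀ {a b} → R a b → ∀ a' → a ⟶ a' → ∃ λ b' → (b ⟶* b') × R a' b'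
  R-step r = proj₁ (progress _ _ r)

  R-value : ∀ {a b} → R a b → ∀ v → a ≡ val v → ∃ λ w → (b ⇓ val w) × ValExt R v w
  R-value r = proj₁ (proj₂ (progress _ _ r))

  R-stuck : ∀ {a b} → R a b → Stuck a → ∃ λ b' → (b ⇓ b') × NFExt R a b'
  R-stuck r = proj₂ (proj₂ (progress _ _ r))

  mutual
    redex-∼ : ∀ {a₀ a₁ b₀ b₁ c} → a₀ ∼ᵛ a₁ → b₀ ∼ᵛ b₁ → Step (app (val a₀) (val b₀)) c →
      ∃ λ c₁ → Steps (app (val a₁) (val b₁)) c₁ × c ∼ c₁
    redex-∼ (∼var n)  b∼ st       = ⊥-elim (open-stuck-irreducible □ᶠ st)
    redex-∼ (∼lam a∼) b∼ (βᵥ t v) = _ , βᵥ _ _ ◅ ε , []-∼ a∼ b∼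
    redex-∼ (∼lam a∼) b∼ (appˡ _ ())
    redex-∼ (∼lam a∼) b∼ (appʳ _ ())
    redex-∼ (instᵛ {lam t} v∼ σ∼) b∼ st = inst-lam-redex v∼ σ∼ b∼ st
    redex-∼ (instᵛ {var y} v∼ σ∼) b∼ st = inst-var-redex v∼ σ∼ b∼ st

    inst-lam-redex : ∀ {t v₁ σ₀ σ₁ b₀ b₁ c} → ValExt R (lam t) v₁ → σ₀ ∼ˢ σ₁ → b₀ ∼ᵛ b₁ →
      Step (app (val (subV σ₀ (lam t))) (val b₀)) c →
      ∃ λ c₁ → Steps (app (val (subV σ₁ v₁)) (val b₁)) c₁ × c ∼ c₁
    inst-lam-redex {t} {v₁} {σ₀} {σ₁} {b₀} {b₁} {c} v∼ σ∼ b∼ st with fresh-Val² (lam t) v₁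
    ... | x , nf₀ , nf₁ with R-step (v∼ x nf₀ nf₁) _ (Step⇒⟶ (βᵥ t (var x)))
    ... | t₁' , st₁ , r' =
      subT (update σ₁ x b₁) t₁' ,
      ≡-Steps (app-as-update σ₁ x b₁ v₁ nf₁) (subT-Steps _ (⟶*⇒Steps st₁)) refl ,
      subst₂ _∼_ (Step-deterministic (subT-Step _ (βᵥ t (var x))) st') refl (inst r' (update-∼ˢ σ∼ x b∼))
      where
      st' : Step (subT (update σ₀ x b₀) (app (val (lam t)) (val (var x)))) c
      st' = subst (λ z → Step z c) (app-as-update σ₀ x b₀ (lam t) nf₀) st

    -- R relates the open-stuck term y x to some F₁[y u₁]; once y is substituted the
    -- redex is simulated by the smaller proof σ∼ y.
    inst-var-redex : ∀ {y v₁ σ₀ σ₁ b₀ b₁ c} → ValExt R (var y) v₁ → σ₀ ∼ˢ σ₁ → b₀ ∼ᵛ b₁ →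
      Step (app (val (σ₀ y)) (val b₀)) c →
      ∃ λ c₁ → Steps (app (val (subV σ₁ v₁)) (val b₁)) c₁ × c ∼ c₁
    inst-var-redex {y} {v₁} {σ₀} {σ₁} {b₀} {b₁} v∼ σ∼ b∼ st with fresh-Val² (var y) v₁
    ... | x , nf₀ , nf₁ with R-stuck (v∼ x nf₀ nf₁) (inj₂ (□ᶠ , y , var x , refl))
    ... | _ , (st₁ , _) , nf with open-stuck-app-NFExt nf
    ... | E₁ , u₁ , refl , E∼ , u∼
      with redex-∼ (σ∼ y) (subst₂ _∼ᵛ_ (update-hit σ₀ x b₀) refl (instᵛ {var x} u∼ (update-∼ˢ σ∼ x b∼))) st
    ... | c₁ , st₂ , c∼ =
      plugE (subE σ₁' E₁) c₁ ,
      ≡-Steps (app-as-update σ₁ x b₁ v₁ nf₁) (subT-Steps σ₁' (⟶*⇒Steps st₁)) plugged ◅◅ plugE-Steps (subE σ₁' E₁) st₂ ,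
      inst-pure {E₀ = □} E∼ (update-∼ˢ σ∼ x b∼) c∼
      where
      σ₁' : ℕ → Val
      σ₁' = update σ₁ x b₁
      plugged : subT σ₁' (plugE E₁ (app (val (var y)) (val u₁))) ≡
                plugE (subE σ₁' E₁) (app (val (σ₁ y)) (val (subV σ₁' u₁)))
      plugged = trans (subT-plugE σ₁' E₁ _)
        (cong (λ w → plugE (subE σ₁' E₁) (app (val w) (val (subV σ₁' u₁)))) (update-miss σ₁ x b₁ nf₀))

  inst-step-nf : ∀ {t₀ t₁ σ₀ σ₁ s₀'} → OpenStuck t₀ → σ₀ ∼ˢ σ₁ → Step (subT σ₀ t₀) s₀' →
    ∃ (λ t₁' → (t₁ ⇓ t₁') × NFExt R t₀ t₁') → ∃ λ s₁' → Steps (subT σ₁ t₁) s₁' × s₀' ∼ s₁'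
  inst-step-nf (F , _ , _ , eq) σ∼ st (_ , _ , inj₁ (E₀ , _ , _ , _ , eq' , _)) =
    ⊥-elim (plugF-appVal≢plugE-shift F E₀ (trans (sym eq) eq'))
  inst-step-nf {σ₀ = σ₀} {σ₁} {s₀'} _ σ∼ st (_ , (st₁ , _) , inj₂ (F₀ , y , _ , F₁ , _ , refl , refl , F∼ , u∼))
    with plugF-redex-Step (subF σ₀ F₀) (subst (λ z → Step z s₀') (subT-plugF σ₀ F₀ _) st)
  ... | c , stc , refl with redex-∼ (σ∼ y) (instᵛ u∼ σ∼) stc
  ... | c₁ , stc₁ , c∼ =
    plugF (subF σ₁ F₁) c₁ ,
    ≡-Steps refl (subT-Steps σ₁ (⟶*⇒Steps st₁)) (subT-plugF σ₁ F₁ _) ◅◅ plugF-Steps (subF σ₁ F₁) stc₁ ,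
    CtxExt-∼ F∼ σ∼ c∼

  inst-step : ∀ {t₀ t₁ σ₀ σ₁ s₀'} → R t₀ t₁ → σ₀ ∼ˢ σ₁ → Step (subT σ₀ t₀) s₀' →
    ∃ λ s₁' → Steps (subT σ₁ t₁) s₁' × s₀' ∼ s₁'
  inst-step {t₀} {σ₀ = σ₀} {s₀' = s₀'} r σ∼ st with shape t₀
  ... | value v refl         = ⊥-elim (val-irreducible st)
  ... | control E b refl     =
    ⊥-elim (control-irreducible (subE σ₀ E) (subst (λ z → Step z s₀') (subT-plugE σ₀ E (shift b)) st))
  ... | open-stuck F y v eq  = inst-step-nf (F , y , v , eq) σ∼ st (R-stuck r (inj₂ (F , y , v , eq)))
  ... | reducible t₀' st₀ with R-step r t₀' (Step⇒⟶ st₀)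
  ...   | t₁' , st₁ , r' =
    subT _ t₁' , subT-Steps _ (⟶*⇒Steps st₁) , subst₂ _∼_ (Step-deterministic (subT-Step σ₀ st₀) st) refl (inst r' σ∼)

  inst-value : ∀ {t₀ t₁ σ₀ σ₁ v₀} → R t₀ t₁ → σ₀ ∼ˢ σ₁ → subT σ₀ t₀ ≡ val v₀ →
    ∃ λ v₁ → Steps (subT σ₁ t₁) (val v₁) × v₀ ∼ᵛ v₁
  inst-value {val w} {σ₁ = σ₁} r σ∼ refl with R-value r w refl
  ... | v₁ , (st , _) , v∼ = subV σ₁ v₁ , subT-Steps σ₁ (⟶*⇒Steps st) , instᵛ v∼ σ∼
  inst-value {app _ _} r σ∼ ()
  inst-value {shift _} r σ∼ ()
  inst-value {reset _} r σ∼ ()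

  inst-control-nf : ∀ {t₀ t₁ σ₀ σ₁ E₀ b₀} → σ₀ ∼ˢ σ₁ → subT σ₀ t₀ ≡ plugE E₀ (shift b₀) →
    ∃ (λ t₁' → (t₁ ⇓ t₁') × NFExt R t₀ t₁') →
    ∃₂ λ E₁ b₁ → Steps (subT σ₁ t₁) (plugE E₁ (shift b₁)) × E₀ ∼ᴱ E₁ × b₀ ∼ᴮ b₁
  inst-control-nf {σ₀ = σ₀} {E₀ = E₀} σ∼ eq (_ , _ , inj₂ (F₀ , _ , _ , _ , _ , refl , _)) =
    ⊥-elim (plugF-appVal≢plugE-shift (subF σ₀ F₀) E₀ (trans (sym (subT-plugF σ₀ F₀ _)) eq))
  inst-control-nf {σ₀ = σ₀} {σ₁} {E₀} σ∼ eq (_ , (st₁ , _) , inj₁ (A₀ , a₀ , A₁ , a₁ , refl , refl , A∼ , a∼))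
    with plugE-shift-injective (subE σ₀ A₀) E₀ (trans (sym (subT-plugE σ₀ A₀ (shift a₀))) eq)
  ... | refl , refl =
    subE σ₁ A₁ , subT (exts σ₁) a₁ ,
    ≡-Steps refl (subT-Steps σ₁ (⟶*⇒Steps st₁)) (subT-plugE σ₁ A₁ (shift a₁)) ,
    inst-pure-∼ᴱ A∼ σ∼ , inst-body-∼ᴮ a∼ σ∼

  inst-control : ∀ {t₀ t₁ σ₀ σ₁ E₀ b₀} → R t₀ t₁ → σ₀ ∼ˢ σ₁ → subT σ₀ t₀ ≡ plugE E₀ (shift b₀) →
    ∃₂ λ E₁ b₁ → Steps (subT σ₁ t₁) (plugE E₁ (shift b₁)) × E₀ ∼ᴱ E₁ × b₀ ∼ᴮ b₁
  inst-control {t₀} {σ₀ = σ₀} {E₀ = E₀} r σ∼ eq with shape t₀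
  ... | value v refl         = ⊥-elim (val≢plugE-shift E₀ eq)
  ... | reducible t₀' st₀    = ⊥-elim (control-irreducible E₀ (subst (λ z → Step z _) eq (subT-Step σ₀ st₀)))
  ... | control E b eq'      = inst-control-nf σ∼ eq (R-stuck r (inj₁ (E , b , eq')))
  ... | open-stuck F y v eq' = inst-control-nf σ∼ eq (R-stuck r (inj₂ (F , y , v , eq')))

  ∼-value : ∀ {s₀ s₁ v₀} → s₀ ∼ s₁ → s₀ ≡ val v₀ → ∃ λ v₁ → Steps s₁ (val v₁) × v₀ ∼ᵛ v₁
  ∼-value (inst r σ∼) eq = inst-value r σ∼ eq
  ∼-value {v₀ = v₀} (inst-pure {□} {E₁} {σ₀} {σ₁} E∼ σ∼ q∼) eq with ∼-value q∼ eq
  ... | w , st , w∼ with fresh-PCtx² □ E₁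
  ... | x , nf₀ , nf₁ with inst-value (E∼ x nf₀ nf₁) (update-∼ˢ σ∼ x w∼) (cong val (update-hit σ₀ x v₀))
  ... | v₁ , st' , v∼ = v₁ , plugE-Steps (subE σ₁ E₁) st ◅◅ ≡-Steps (plugE-as-update σ₁ x w E₁ nf₁) st' refl , v∼
  ∼-value (inst-pure {_ ·ᵣ _} _ _ _) ()
  ∼-value (inst-pure {_ ·ₗ _} _ _ _) ()
  ∼-value (inst-reset _ _ _) ()
  ∼-value (inst-outer {G₀} {σ₀ = σ₀} _ _ _) eq = ⊥-elim (plugF≢val reset-NotValue (subF σ₀ G₀) eq)
  ∼-value (∼val v∼) refl = _ , ε , v∼
  ∼-value (∼app _ _) ()
  ∼-value (∼shift _) ()
  ∼-value (∼reset _) ()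

  mutual
    ∼-control : ∀ {s₀ s₁} E₀ {b₀} → s₀ ∼ s₁ → s₀ ≡ plugE E₀ (shift b₀) →
      ∃₂ λ E₁ b₁ → Steps s₁ (plugE E₁ (shift b₁)) × E₀ ∼ᴱ E₁ × b₀ ∼ᴮ b₁
    ∼-control E₀ (inst r σ∼) eq = inst-control r σ∼ eq
    ∼-control E₀ (inst-pure {q₀ = q₀} A∼ σ∼ q∼) eq = inst-pure-control E₀ A∼ σ∼ q∼ eq (shape q₀)
    ∼-control E₀ (inst-reset _ _ _) eq = ⊥-elim (reset≢plugE-shift E₀ eq)
    ∼-control E₀ (inst-outer {G₀} {σ₀ = σ₀} _ _ _) eq =
      ⊥-elim (plugF≢plugE-shift reset-NotValue reset-NotControl (subF σ₀ G₀) E₀ eq)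
    ∼-control E₀ (∼val _) eq = ⊥-elim (val≢plugE-shift E₀ eq)
    ∼-control □ (∼app _ _) ()
    ∼-control (v ·ᵣ E) (∼app a∼ b∼) refl with ∼-value a∼ refl | ∼-control E b∼ refl
    ... | v₁ , st₁ , v∼ | E₁ , b₁ , st₂ , E∼ , body∼ =
      v₁ ·ᵣ E₁ , b₁ , appˡ-Steps _ st₁ ◅◅ appʳ-Steps v₁ st₂ ,
      (λ q∼ → ∼app (∼val (subV-∼ᵛ v∼ (var-∼ʳˢ suc))) (E∼ q∼)) , body∼
    ∼-control (E ·ₗ t) (∼app a∼ b∼) refl with ∼-control E a∼ refl
    ... | E₁ , b₁ , st₁ , E∼ , body∼ =
      E₁ ·ₗ _ , b₁ , appˡ-Steps _ st₁ , (λ q∼ → ∼app (E∼ q∼) (subT-∼ b∼ (var-∼ʳˢ suc))) , body∼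
    ∼-control □ (∼shift a∼) refl = □ , _ , ε , (λ q∼ → q∼) , (λ c∼ → ∼reset ([]-∼ a∼ c∼))
    ∼-control (_ ·ᵣ _) (∼shift _) ()
    ∼-control (_ ·ₗ _) (∼shift _) ()
    ∼-control E₀ (∼reset _) eq = ⊥-elim (reset≢plugE-shift E₀ eq)

    inst-pure-control : ∀ {A₀ A₁ σ₀ σ₁ q₀ q₁} E₀ {b₀} → PureExt R A₀ A₁ → σ₀ ∼ˢ σ₁ → q₀ ∼ q₁ →
      plugE (subE σ₀ A₀) q₀ ≡ plugE E₀ (shift b₀) → Shape q₀ →
      ∃₂ λ E₁ b₁ → Steps (plugE (subE σ₁ A₁) q₁) (plugE E₁ (shift b₁)) × E₀ ∼ᴱ E₁ × b₀ ∼ᴮ b₁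
    inst-pure-control {A₀} {A₁} {σ₀} {σ₁} E₀ A∼ σ∼ q∼ eq (value v refl) with ∼-value q∼ refl | fresh-PCtx² A₀ A₁
    ... | w , st , w∼ | x , nf₀ , nf₁
      with inst-control (A∼ x nf₀ nf₁) (update-∼ˢ σ∼ x w∼) (trans (sym (plugE-as-update σ₀ x v A₀ nf₀)) eq)
    ... | E₁ , b₁ , st' , E∼ , body∼ =
      E₁ , b₁ , plugE-Steps (subE σ₁ A₁) st ◅◅ ≡-Steps (plugE-as-update σ₁ x w A₁ nf₁) st' refl , E∼ , body∼
    inst-pure-control E₀ _ _ _ eq (reducible _ st) =
      ⊥-elim (control-irreducible E₀ (subst (λ z → Step z _) eq (plugE-Step _ st)))
    inst-pure-control {A₀} {σ₀ = σ₀} E₀ _ _ _ eq (open-stuck F y v refl) =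
      ⊥-elim (plugF-appVal≢plugE-shift (pure (subE σ₀ A₀) ∘F F) E₀ (trans (plugF-pure-∘ (subE σ₀ A₀) F _) eq))
    inst-pure-control {A₀} {A₁} {σ₀} {σ₁} E₀ A∼ σ∼ q∼ eq (control E b refl)
      with plugE-shift-injective (subE σ₀ A₀ ∘E E) E₀ (trans (plugE-∘ (subE σ₀ A₀) E (shift b)) eq)
    ... | refl , refl with ∼-control E q∼ refl
    ... | E₁ , b₁ , st , E∼ , body∼ =
      subE σ₁ A₁ ∘E E₁ , b₁ ,
      ≡-Steps refl (plugE-Steps (subE σ₁ A₁) st) (sym (plugE-∘ (subE σ₁ A₁) E₁ (shift b₁))) ,
      inst-pure-∘E-∼ᴱ A∼ σ∼ E∼ , body∼

  mutual
    ∼-step : ∀ {s₀ s₁ s₀'} → s₀ ∼ s₁ → Step s₀ s₀' → ∃ λ s₁' → Steps s₁ s₁' × s₀' ∼ s₁'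
    ∼-step (inst r σ∼) st = inst-step r σ∼ st
    ∼-step (inst-pure {q₀ = q₀} A∼ σ∼ q∼) st = inst-pure-step A∼ σ∼ q∼ st (shape q₀)
    ∼-step (inst-reset {q₀ = q₀} A∼ σ∼ q∼) st = inst-reset-step A∼ σ∼ q∼ st (shape q₀)
    ∼-step (inst-outer {r₀ = r₀} G∼ σ∼ q∼) st = inst-outer-step G∼ σ∼ q∼ st (shape (reset r₀))
    ∼-step (∼val _) ()
    ∼-step (∼app a∼ b∼) (βᵥ t v) with ∼-value a∼ refl | ∼-value b∼ refl
    ... | a₁ , st₁ , a∼' | b₁ , st₂ , b∼' with redex-∼ a∼' b∼' (βᵥ t v)
    ... | c₁ , st₃ , c∼ = c₁ , appˡ-Steps _ st₁ ◅◅ appʳ-Steps a₁ st₂ ◅◅ st₃ , c∼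
    ∼-step (∼app a∼ b∼) (appˡ b st) with ∼-step a∼ st
    ... | a₁' , st₁ , a∼' = app a₁' _ , appˡ-Steps _ st₁ , ∼app a∼' b∼
    ∼-step (∼app a∼ b∼) (appʳ v st) with ∼-value a∼ refl | ∼-step b∼ st
    ... | a₁ , st₁ , a∼' | b₁' , st₂ , b∼' =
      app (val a₁) b₁' , appˡ-Steps _ st₁ ◅◅ appʳ-Steps a₁ st₂ , ∼app (∼val a∼') b∼'
    ∼-step (∼shift _) ()
    ∼-step (∼reset a∼) (βshift E t) with ∼-control E a∼ refl
    ... | E₁ , b₁ , st₁ , E∼ , body∼ =
      reset (b₁ [ contV E₁ ]) , reset-Steps st₁ ◅◅ (βshift E₁ b₁ ◅ ε) , body∼ (contV-∼ᵛ E∼)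
    ∼-step (∼reset a∼) (βreset v) with ∼-value a∼ refl
    ... | w , st₁ , w∼ = val w , reset-Steps st₁ ◅◅ (βreset w ◅ ε) , ∼val w∼
    ∼-step (∼reset a∼) (reset st) with ∼-step a∼ st
    ... | a₁' , st₁ , a∼' = reset a₁' , reset-Steps st₁ , ∼reset a∼'

    inst-pure-step : ∀ {A₀ A₁ σ₀ σ₁ q₀ q₁ s₀'} → PureExt R A₀ A₁ → σ₀ ∼ˢ σ₁ → q₀ ∼ q₁ →
      Step (plugE (subE σ₀ A₀) q₀) s₀' → Shape q₀ →
      ∃ λ s₁' → Steps (plugE (subE σ₁ A₁) q₁) s₁' × s₀' ∼ s₁'
    inst-pure-step {A₀} {A₁} {σ₀} {σ₁} {s₀' = s₀'} A∼ σ∼ q∼ st (value v refl)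
      with ∼-value q∼ refl | fresh-PCtx² A₀ A₁
    ... | w , st₁ , w∼ | x , nf₀ , nf₁
      with inst-step (A∼ x nf₀ nf₁) (update-∼ˢ σ∼ x w∼) (subst (λ z → Step z s₀') (plugE-as-update σ₀ x v A₀ nf₀) st)
    ... | s₁' , st₂ , s∼ =
      s₁' , plugE-Steps (subE σ₁ A₁) st₁ ◅◅ ≡-Steps (plugE-as-update σ₁ x w A₁ nf₁) st₂ refl , s∼
    inst-pure-step {σ₀ = σ₀} {σ₁} A∼ σ∼ q∼ st (reducible _ stq) with ∼-step q∼ stq
    ... | q₁' , st₁ , q∼' =
      plugE (subE σ₁ _) q₁' , plugE-Steps _ st₁ ,
      subst₂ _∼_ (Step-deterministic (plugE-Step _ stq) st) refl (inst-pure A∼ σ∼ q∼')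
    inst-pure-step {A₀} {σ₀ = σ₀} {s₀' = s₀'} _ _ _ st (control E b refl) =
      ⊥-elim (control-irreducible (subE σ₀ A₀ ∘E E) (subst (λ z → Step z s₀') (sym (plugE-∘ (subE σ₀ A₀) E _)) st))
    inst-pure-step {A₀} {σ₀ = σ₀} {s₀' = s₀'} _ _ _ st (open-stuck F y v refl) =
      ⊥-elim (open-stuck-irreducible (pure (subE σ₀ A₀) ∘F F)
        (subst (λ z → Step z s₀') (sym (plugF-pure-∘ (subE σ₀ A₀) F _)) st))

    inst-reset-step : ∀ {A₀ A₁ σ₀ σ₁ q₀ q₁ s₀'} → ResetExt A₀ A₁ → σ₀ ∼ˢ σ₁ → q₀ ∼ q₁ →
      Step (reset (plugE (subE σ₀ A₀) q₀)) s₀' → Shape q₀ →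
      ∃ λ s₁' → Steps (reset (plugE (subE σ₁ A₁) q₁)) s₁' × s₀' ∼ s₁'
    inst-reset-step {A₀} {A₁} {σ₀} {σ₁} {s₀' = s₀'} A∼ σ∼ q∼ st (value v refl)
      with ∼-value q∼ refl | fresh-PCtx² A₀ A₁
    ... | w , st₁ , w∼ | x , nf₀ , nf₁
      with inst-step (A∼ x nf₀ nf₁) (update-∼ˢ σ∼ x w∼)
             (subst (λ z → Step z s₀') (cong reset (plugE-as-update σ₀ x v A₀ nf₀)) st)
    ... | s₁' , st₂ , s∼ =
      s₁' ,
      reset-Steps (plugE-Steps (subE σ₁ A₁) st₁) ◅◅ ≡-Steps (cong reset (plugE-as-update σ₁ x w A₁ nf₁)) st₂ refl ,
      s∼
    inst-reset-step {σ₀ = σ₀} {σ₁} A∼ σ∼ q∼ st (reducible _ stq) with ∼-step q∼ stq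
    ... | q₁' , st₁ , q∼' =
      reset (plugE (subE σ₁ _) q₁') , reset-Steps (plugE-Steps _ st₁) ,
      subst₂ _∼_ (Step-deterministic (reset (plugE-Step _ stq)) st) refl (inst-reset A∼ σ∼ q∼')
    inst-reset-step {A₀} {σ₀ = σ₀} {s₀' = s₀'} _ _ _ st (open-stuck F y v refl) =
      ⊥-elim (open-stuck-irreducible ⟨ pure (subE σ₀ A₀) ∘F F ⟩ᶠ
        (subst (λ z → Step z s₀') (cong reset (sym (plugF-pure-∘ (subE σ₀ A₀) F _))) st))
    inst-reset-step {A₀} {A₁} {σ₀} {σ₁} {s₀' = s₀'} A∼ σ∼ q∼ st (control E b refl) with ∼-control E q∼ refl
    ... | E₁ , b₁ , st₁ , E∼ , body∼ =
      reset (b₁ [ contV (subE σ₁ A₁ ∘E E₁) ]) ,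
      reset-Steps (≡-Steps refl (plugE-Steps (subE σ₁ A₁) st₁) (sym (plugE-∘ (subE σ₁ A₁) E₁ (shift b₁))))
        ◅◅ (βshift (subE σ₁ A₁ ∘E E₁) b₁ ◅ ε) ,
      subst₂ _∼_ captured refl (body∼ (inst-reset-contV-∼ᵛ A∼ σ∼ E∼))
      where
      captured : reset (b [ contV (subE σ₀ A₀ ∘E E) ]) ≡ s₀'
      captured = Step-deterministic (subst (λ z → Step (reset z) (reset (b [ contV (subE σ₀ A₀ ∘E E) ])))
                                           (plugE-∘ (subE σ₀ A₀) E (shift b)) (βshift (subE σ₀ A₀ ∘E E) b)) st

    inst-outer-step : ∀ {G₀ G₁ σ₀ σ₁ r₀ q₁ s₀'} → OuterExt G₀ G₁ → σ₀ ∼ˢ σ₁ → reset r₀ ∼ q₁ →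
      Step (plugF (subF σ₀ G₀) (reset r₀)) s₀' → Shape (reset r₀) →
      ∃ λ s₁' → Steps (plugF (subF σ₁ G₁) q₁) s₁' × s₀' ∼ s₁'
    inst-outer-step _ _ _ _ (value _ ())
    inst-outer-step _ _ _ _ (control E _ eq) = ⊥-elim (reset≢plugE-shift E eq)
    inst-outer-step {G₀} {σ₀ = σ₀} {s₀' = s₀'} _ _ _ st (open-stuck F y v eq) =
      ⊥-elim (open-stuck-irreducible (subF σ₀ G₀ ∘F F)
        (subst (λ z → Step z s₀') (trans (cong (plugF (subF σ₀ G₀)) eq) (sym (plugF-∘ (subF σ₀ G₀) F _))) st))
    inst-outer-step {G₀} {G₁} {σ₀} {σ₁} G∼ σ∼ q∼ st (reducible _ stq) with ∼-step q∼ stq | Step-reset-result stq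
    ... | q₁' , st₁ , q∼' | inj₁ (_ , refl) =
      plugF (subF σ₁ G₁) q₁' , plugF-Steps (subF σ₁ G₁) st₁ ,
      subst₂ _∼_ (Step-deterministic (plugF-Step (subF σ₀ G₀) stq) st) refl (inst-outer G∼ σ∼ q∼')
    ... | q₁' , st₁ , q∼' | inj₂ (v , refl) with ∼-value q∼' refl | fresh-ECtx² G₀ G₁
    ...   | w , st₂ , w∼ | x , nf₀ , nf₁ =
      plugF (subF σ₁ G₁) (val w) , plugF-Steps (subF σ₁ G₁) (st₁ ◅◅ st₂) ,
      subst₂ _∼_ (trans (sym (plugF-as-update σ₀ x v G₀ nf₀)) (Step-deterministic (plugF-Step (subF σ₀ G₀) stq) st))
                 (sym (plugF-as-update σ₁ x w G₁ nf₁))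
        (inst (G∼ x nf₀ nf₁) (update-∼ˢ σ∼ x w∼))

  ∼-steps : ∀ {s₀ s₁ s₀'} → s₀ ∼ s₁ → Steps s₀ s₀' → ∃ λ s₁' → Steps s₁ s₁' × s₀' ∼ s₁'
  ∼-steps s∼ ε = _ , ε , s∼
  ∼-steps s∼ (st ◅ sts) with ∼-step s∼ st
  ... | _ , st₁ , s∼' with ∼-steps s∼' sts
  ...   | s₁'' , st₂ , s∼'' = s₁'' , st₁ ◅◅ st₂ , s∼''

  ∼-EvalsToValue : ∀ {s₀ s₁} → s₀ ∼ s₁ → EvalsToValue s₀ → EvalsToValue s₁
  ∼-EvalsToValue s∼ (_ , st) with ∼-steps s∼ (⟶*⇒Steps st)
  ... | _ , st₁ , s∼' with ∼-value s∼' refl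
  ...   | w , st₂ , _ = w , Steps⇒⟶* (st₁ ◅◅ st₂)

  ∼-EvalsToControlStuck : ∀ {s₀ s₁} → s₀ ∼ s₁ → EvalsToControlStuck s₀ → EvalsToControlStuck s₁
  ∼-EvalsToControlStuck s∼ (_ , st , E , b , refl) with ∼-steps s∼ (⟶*⇒Steps st)
  ... | _ , st₁ , s∼' with ∼-control E s∼' refl
  ...   | E₁ , b₁ , st₂ , _ = plugE E₁ (shift b₁) , Steps⇒⟶* (st₁ ◅◅ st₂) , E₁ , b₁ , refl

  observations-preserved : ∀ {t₀ t₁} → R t₀ t₁ → ∀ σ C →
    (EvalsToValue (plugC C (subT σ t₀)) → EvalsToValue (plugC C (subT σ t₁))) ×
    (EvalsToControlStuck (plugC C (subT σ t₀)) → EvalsToControlStuck (plugC C (subT σ t₁)))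
  observations-preserved {t₀} {t₁} r σ C = ∼-EvalsToValue C∼ , ∼-EvalsToControlStuck C∼
    where
    C∼ : plugC C (subT σ t₀) ∼ plugC C (subT σ t₁)
    C∼ = plugC-∼ C (inst r (λ n → ∼ᵛ-refl (σ n)))

NFBisimulation-observations : ∀ {R t₀ t₁} → IsNFBisimulation R → R t₀ t₁ → ∀ σ C →
  (EvalsToValue (plugC C (subT σ t₀)) ⇔ EvalsToValue (plugC C (subT σ t₁))) ×
  (EvalsToControlStuck (plugC C (subT σ t₀)) ⇔ EvalsToControlStuck (plugC C (subT σ t₁)))
NFBisimulation-observations {R} bisim r σ C
  with Simulation.observations-preserved R (λ a b → proj₁ ∘ bisim a b) r σ C
     | Simulation.observations-preserved (flip R) (λ a b → proj₂ ∘ bisim b a) r σ C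
... | value⇒ , control⇒ | value⇐ , control⇐ = mk⇔ value⇒ value⇐ , mk⇔ control⇒ control⇐

theorem6p7 : ∀ (t₀ t₁ : Tm) → t₀ ≈nf t₁ → t₀ ≅° t₁
theorem6p7 t₀ t₁ (R , bisim , r) σ _ C _ = NFBisimulation-observations bisim r σ C
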